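{- Let $\mathcal A$ be a finite alphabet with $r$ letters, equipped with a pair of strict total orders $(<_A,<_D)$. Let $L$ be a language on $\mathcal A$ satisfying the order condition for $(<_A,<_D)$. Let $w\in L$ and let $U_1,\dots,U_s$ ($1\le s\le r$) be $s$ distinct suffix return words (resp. prefix return words) of $w$ in $L$. Let $\mathcal A'=\{a_1,\dots,a_s\}$ and let $\phi:\mathcal A'^*\to\mathcal A^*$ be the morphism with $\phi a_i=U_i$. Define on $\mathcal A'$ the derived orders with respect to $w$: (1) $a_i<_{Aw}a_j$ iff, comparing the words $w\phi a_i$ and $w\phi a_j$ from right to left (i.e. aligned at their last letters), at the first position from the right where they differ the letter of $w\phi a_i$ is $<_A$-smaller than that of $w\phi a_j$ (antilexicographic order induced by $<_A$); (2) $a_i<_{Dw}a_j$ iff, comparing $\phi a_i w$ and $\phi a_j w$ from left to right, at the first position where they differ the letter of $\phi a_i w$ is $<_D$-smaller than that of $\phi a_j w$ (lexicographic order induced by $<_D$). Then these are well-defined strict total orders on $\mathcal A'$, and for every word $v$ on $\mathcal A'$, the word $\phi v$ clusters for $(<_A,<_D)$ on $\mathcal A$ if and only if $v$ clusters for $(<_{Aw},<_{Dw})$ on $\mathcal A'$.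
   Context: A language over a finite alphabet is a set $L$ of finite words containing the empty word, closed under taking factors, and extendable (for every $v\in L$ there are letters $a,b$ with $av,vb\in L$). A word $v\in L$ is bispecial if there are at least two letters $x$ with $xv\in L$ and at least two letters $y$ with $vy\in L$. A bispecial word $v$ satisfies the order condition for a pair of strict total orders $(<_A,<_D)$ if whenever $xvy, x'vy'\in L$ with letters $x\neq x'$, $y\ne y'$, then $x<_Ax'$ iff $y<_Dy'$; $L$ satisfies the order condition if all its bispecial words (including the empty word) do. A suffix return word of $w$ in $L$ is a word $v\in L$ such that $wv\in L$ has exactly two occurrences of $w$, one as a prefix and one as a suffix; a prefix return word of $w$ is a word $v\in L$ such that $vw\in L$ has exactly two occurrences of $w$, one as a prefix and one as a suffix. For a word $u=u_1\cdots u_n$, its cyclic conjugates are the $n$ words $u_i\cdots u_nu_1\cdots u_{i-1}$, $1\le i\le n$ (counted with multiplicity). The Burrows–Wheeler transform $B(u)$ is obtained by listing these $n$ conjugates in non-decreasing lexicographic order with respect to $<_D$ and concatenating their last letters. The word $u$ clusters for $(<_A,<_D)$ if $B(u)=c_1^{n_{c_1}}\cdots c_r^{n_{c_r}}$, where $c_1<_A\cdots<_Ac_r$ are the letters of the alphabet and $n_c$ is the number of occurrences of $c$ in $u$. -}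

module Defs where

open import Level using (0ℓ)
open import Data.Nat using (ℕ; suc; _∸_)
open import Data.Fin using (Fin; _≟_)
open import Data.List using (List; []; _∷_; _++_; [_]; length; filter; take; drop; upTo; map; concatMap; replicate; last; allFin)
open import Data.List.Properties using (≡-dec)
open import Data.List.Relation.Unary.Linked using (Linked)
open import Data.List.Relation.Binary.Lex.Strict using (Lex-≤)
open import Data.List.Relation.Binary.Permutation.Propositional using (_↭_)
open import Data.Maybe using (Maybe; just)
open import Data.Product using (Σ; ∃; ∃-syntax; _×_; _,_)
open import Relation.Binary using (Rel)
open import Relation.Binary.PropositionalEquality using (_≡_; _≢_)
open import Function.Bundles using (_⇔_)

Word : ℕ → Set
Word r = List (Fin r)

Language : ℕ → Set₁
Language r = Word r → Set

IsLanguage : ∀ {r} → Language r → Set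
IsLanguage {r} L =
  L [] ×
  (∀ (u v x : Word r) → L (u ++ v ++ x) → L v) ×
  (∀ (v : Word r) → L v → (∃[ a ] L (a ∷ v)) × (∃[ b ] L (v ++ [ b ])))

Bispecial : ∀ {r} → Language r → Word r → Set
Bispecial {r} L v =
  L v ×
  (Σ (Fin r) λ x → Σ (Fin r) λ x' → x ≢ x' × L (x ∷ v) × L (x' ∷ v)) ×
  (Σ (Fin r) λ y → Σ (Fin r) λ y' → y ≢ y' × L (v ++ [ y ]) × L (v ++ [ y' ]))

OrderConditionAt : ∀ {r} → Language r → Rel (Fin r) 0ℓ → Rel (Fin r) 0ℓ → Word r → Set
OrderConditionAt {r} L _<A_ _<D_ v =
  ∀ (x x' y y' : Fin r) → x ≢ x' → y ≢ y' →
  L (x ∷ v ++ [ y ]) → L (x' ∷ v ++ [ y' ]) → (x <A x') ⇔ (y <D y')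

OrderCondition : ∀ {r} → Language r → Rel (Fin r) 0ℓ → Rel (Fin r) 0ℓ → Set
OrderCondition {r} L _<A_ _<D_ =
  ∀ (v : Word r) → Bispecial L v → OrderConditionAt L _<A_ _<D_ v

occurrences : ∀ {r} → Word r → Word r → ℕ
occurrences {r} w u =
  length (filter (λ i → ≡-dec _≟_ (take (length w) (drop i u)) w)
                 (upTo (suc (length u ∸ length w))))

IsPrefix : ∀ {r} → Word r → Word r → Set
IsPrefix {r} w u = Σ (Word r) λ q → w ++ q ≡ u

IsSuffix : ∀ {r} → Word r → Word r → Set
IsSuffix {r} w u = Σ (Word r) λ p → p ++ w ≡ u

SuffixReturnWord : ∀ {r} → Language r → Word r → Word r → Set
SuffixReturnWord L w v =
  L v × L (w ++ v) × occurrences w (w ++ v) ≡ 2 ×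
  IsPrefix w (w ++ v) × IsSuffix w (w ++ v)

PrefixReturnWord : ∀ {r} → Language r → Word r → Word r → Set
PrefixReturnWord L w v =
  L v × L (v ++ w) × occurrences w (v ++ w) ≡ 2 ×
  IsPrefix w (v ++ w) × IsSuffix w (v ++ w)

morph : ∀ {s r} → (Fin s → Word r) → Word s → Word r
morph φ v = concatMap φ v

conjugates : ∀ {r} → Word r → List (Word r)
conjugates u = map (λ i → drop i u ++ take i u) (upTo (length u))

count : ∀ {r} → Fin r → Word r → ℕ
count c u = length (filter (λ d → c ≟ d) u)

IsBWT : ∀ {r} → Rel (Fin r) 0ℓ → Word r → Word r → Set
IsBWT {r} _<D_ u b =
  Σ (List (Word r)) λ ks →
    (ks ↭ conjugates u) ×
    Linked (Lex-≤ _≡_ _<D_) ks ×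
    map last ks ≡ map just b

-- u clusters for (<A,<D): B(u) = c₁^{n_c₁} ⋯ c_r^{n_c_r} with c₁ <A ⋯ <A c_r
Clusters : ∀ {r} → Rel (Fin r) 0ℓ → Rel (Fin r) 0ℓ → Word r → Set
Clusters {r} _<A_ _<D_ u =
  Σ (List (Fin r)) λ cs →
    (cs ↭ allFin r) × Linked _<A_ cs ×
    IsBWT _<D_ u (concatMap (λ c → replicate (count c u) c) cs)

AntiLex< : ∀ {r} → Rel (Fin r) 0ℓ → Rel (Word r) 0ℓ
AntiLex< {r} _<A_ x y =
  Σ (Word r) λ p → Σ (Word r) λ q → Σ (Fin r) λ c → Σ (Fin r) λ d → Σ (Word r) λ t →
    x ≡ p ++ c ∷ t × y ≡ q ++ d ∷ t × c <A d

Lex< : ∀ {r} → Rel (Fin r) 0ℓ → Rel (Word r) 0ℓ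
Lex< {r} _<D_ x y =
  Σ (Word r) λ p → Σ (Fin r) λ c → Σ (Fin r) λ d → Σ (Word r) λ t → Σ (Word r) λ t' →
    x ≡ p ++ c ∷ t × y ≡ p ++ d ∷ t' × c <D d

DerivedA : ∀ {s r} → Rel (Fin r) 0ℓ → (Fin s → Word r) → Word r → Rel (Fin s) 0ℓ
DerivedA _<A_ φ w i j = AntiLex< _<A_ (w ++ φ i) (w ++ φ j)

DerivedD : ∀ {s r} → Rel (Fin r) 0ℓ → (Fin s → Word r) → Word r → Rel (Fin s) 0ℓ
DerivedD _<D_ φ w i j = Lex< _<D_ (φ i ++ w) (φ j ++ w)

-- The BWT of u clusters iff no two conjugates of u are sorted by <D while their last letters
-- are sorted the other way by <A; for u ≠ [] this says that the periodic word u^ω has no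
-- inversion. Write (φ v)^ω as a concatenation of return words, each preceded by an occurrence
-- of w; far from the origin w occurs only at these block boundaries. An inversion of v^ω for
-- the derived orders then reads off directly as an inversion of (φ v)^ω. Conversely, given an
-- inversion of (φ v)^ω, either the block containing the first difference starts at most |w|
-- letters after the inverted letter, so that both contexts are factors of L around a bispecial
-- word, which the order condition forbids; or the block boundaries after the two positions are
-- synchronised by the occurrences of w, and the blocks in between form an inversion of v^ω.

module Submission where

open import Defs
open import Level using (0ℓ)
open import Data.Nat using (ℕ; zero; suc; _+_; _*_; _∸_; _≤_; _<_; z≤n; s≤s; pred; _%_; _/_; _≤?_; _<?_)
open import Data.Nat.Properties hiding (_≟_)
open import Algebra.Properties.CommutativeSemigroup +-commutativeSemigroup using (xy∙z≈xz∙y)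
open import Data.Nat.DivMod using ([m+kn]%n≡m%n; [m+n]%n≡m%n; m<n⇒m%n≡m; m≡m%n+[m/n]*n; m%n<n)
open import Data.Nat.Solver using (module +-*-Solver)
open import Data.Fin using (Fin; _≟_)
open import Data.List
  using (List; []; _∷_; _++_; [_]; _∷ʳ_; length; take; drop; reverse; filter; upTo; applyUpTo; map; last;
         allFin; concatMap; replicate)
open import Data.List.Properties
  using (length-++; ++-assoc; ++-identityʳ; ++-cancelˡ; ++-cancelʳ; ∷-injective; take++drop≡id; length-drop;
         reverse-++; reverse-involutive; reverse-injective; unfold-reverse; take-all; ≡-dec; filter-++; filter-accept;
         filter-reject; upTo-∷ʳ; length-filter; map-∘; map-cong; map-cong-local; map-upTo; applyUpTo-∷ʳ; concatMap-++)
open import Data.List.Membership.Propositional using (_∈_)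
open import Data.List.Membership.Propositional.Properties using (∈-allFin; ∈-∃++; ∈-map⁺; ∈-map⁻; ∈-upTo⁺; ∈-upTo⁻)
open import Data.List.Relation.Unary.All using (All; []; _∷_)
  renaming (lookup to All-lookup; map to All-map; tabulate to All-tabulate)
import Data.List.Relation.Unary.All.Properties as All
open import Data.List.Relation.Unary.AllPairs using (AllPairs; []; _∷_) renaming (zip to AllPairs-zip; map to AllPairs-map)
import Data.List.Relation.Unary.AllPairs.Properties as AllPairs
open import Data.List.Relation.Unary.Any using (here; there)
open import Data.List.Relation.Unary.Linked using (Linked; []; [-]; _∷_)
open import Data.List.Relation.Unary.Linked.Properties using (Linked⇒AllPairs; AllPairs⇒Linked)
import Data.List.Relation.Unary.Sorted.TotalOrder.Properties as Sorted
import Data.List.Relation.Unary.Unique.Propositional as Unique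
import Data.List.Relation.Unary.Unique.Propositional.Properties as Unique
import Data.List.Relation.Binary.Permutation.Setoid.Properties as PermutationSetoid
open import Data.List.Relation.Binary.Permutation.Propositional
  using (_↭_; ↭-sym; ↭-trans; ↭-refl; ↭-prep; ↭-reflexive; ↭⇒↭ₛ; ↭⇒↭ₛ′; module PermutationReasoning)
open import Data.List.Relation.Binary.Permutation.Propositional.Properties using (∈-resp-↭; All-resp-↭; shift; ∷↭∷ʳ)
import Data.List.Relation.Binary.Permutation.Propositional.Properties as Permutation
open import Data.List.Relation.Binary.Lex.Strict using (Lex-≤)
import Data.List.Relation.Binary.Lex.Strict as Lex
open import Data.List.Relation.Binary.Lex.Core using (base; this; next)
open import Data.List.Relation.Binary.Pointwise using (Pointwise-≡⇒≡)
import Data.List.Sort as Sort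
open import Data.Maybe using (Maybe; just)
open import Data.Maybe.Properties using (just-injective)
open import Data.Product using (∃-syntax; _×_; _,_; proj₁; proj₂)
open import Data.Sum using (_⊎_; inj₁; inj₂)
open import Data.Empty using (⊥; ⊥-elim)
open import Relation.Binary
  using (Rel; Trichotomous; Irreflexive; Transitive; Asymmetric; IsStrictTotalOrder; StrictTotalOrder; DecTotalOrder;
         tri<; tri≈; tri>)
import Relation.Binary.Construct.StrictToNonStrict as StrictToNonStrict
open import Relation.Binary.PropositionalEquality
  using (_≡_; _≢_; refl; sym; trans; cong; cong₂; subst; subst₂; isEquivalence; resp₂; setoid; module ≡-Reasoning)
open import Relation.Nullary using (¬_; Dec; yes; no)
open import Function.Base using (_∘_; id)
open import Function.Bundles using (_⇔_; Equivalence; mk⇔)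
open import Function.Construct.Composition using (_⇔-∘_)
open import Function.Construct.Symmetry using (⇔-sym)

module _ {A : Set} where

  ++-injectiveˡ : ∀ (x y u v : List A) → length x ≡ length u → x ++ y ≡ u ++ v → x ≡ u × y ≡ v
  ++-injectiveˡ []      y []      v _ e = refl , e
  ++-injectiveˡ (a ∷ x) y (b ∷ u) v l e with ∷-injective e
  ... | refl , e′ with ++-injectiveˡ x y u v (cong pred l) e′
  ... | refl , e″ = refl , e″

  ++-injectiveʳ : ∀ (x y u v : List A) → length y ≡ length v → x ++ y ≡ u ++ v → x ≡ u × y ≡ v
  ++-injectiveʳ x y u v l e = ++-injectiveˡ x y u v |x|≡|u| e
    where
      |x|≡|u| : length x ≡ length u
      |x|≡|u| = +-cancelʳ-≡ (length y) (length x) (length u)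
        (trans (sym (length-++ x)) (trans (cong length e) (trans (length-++ u) (cong (length u +_) (sym l)))))

  take-length-++ : ∀ (x y : List A) → take (length x) (x ++ y) ≡ x
  take-length-++ []      y = refl
  take-length-++ (a ∷ x) y = cong (a ∷_) (take-length-++ x y)

  drop-length-++ : ∀ (x y : List A) → drop (length x) (x ++ y) ≡ y
  drop-length-++ []      y = refl
  drop-length-++ (a ∷ x) y = drop-length-++ x y

  drop-suc-length : ∀ (X : List A) d R → drop (suc (length X)) (X ++ d ∷ R) ≡ R
  drop-suc-length []      d R = refl
  drop-suc-length (x ∷ X) d R = drop-suc-length X d R

  ProperPrefix : Rel (List A) 0ℓ
  ProperPrefix x y = ∃[ c ] ∃[ z ] (y ≡ x ++ c ∷ z)

  ProperSuffix : Rel (List A) 0ℓ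
  ProperSuffix x y = ∃[ c ] ∃[ z ] (y ≡ (c ∷ z) ++ x)

  length-≤-infix : ∀ (p w q : List A) → length w ≤ length (p ++ w ++ q)
  length-≤-infix p w q = subst (length w ≤_) (sym (trans (length-++ p) (cong (length p +_) (length-++ w))))
    (≤-trans (m≤m+n (length w) (length q)) (m≤n+m _ (length p)))

  xs≢xs++y∷ys : ∀ (w : List A) {c z} → ¬ w ≡ w ++ c ∷ z
  xs≢xs++y∷ys w {c} {z} e = m+1+n≢m (length w) (sym (trans (cong length e) (length-++ w)))

  properPrefix-++ˡ⁻ : ∀ (w : List A) {x y} → ProperPrefix (w ++ x) (w ++ y) → ProperPrefix x y
  properPrefix-++ˡ⁻ w {x} (c , z , e) = c , z , ++-cancelˡ w _ _ (trans e (++-assoc w x _))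

  properPrefix-++ʳ⁻ : ∀ (w : List A) {x y} → ProperPrefix (x ++ w) (y ++ w) → ProperPrefix x y
  properPrefix-++ʳ⁻ w {[]}    {[]}    (c , z , e) = ⊥-elim (xs≢xs++y∷ys w e)
  properPrefix-++ʳ⁻ w {[]}    {b ∷ y} _           = b , y , refl
  properPrefix-++ʳ⁻ w {a ∷ x} {[]}    (c , z , e) =
    ⊥-elim (<-irrefl refl (subst (length w <_) (cong length (sym e′)) (s≤s (length-≤-infix x w (c ∷ z)))))
    where
      e′ : w ≡ a ∷ x ++ w ++ c ∷ z
      e′ = trans e (cong (a ∷_) (++-assoc x w _))
  properPrefix-++ʳ⁻ w {a ∷ x} {b ∷ y} (c , z , e) with ∷-injective e
  ... | refl , e′ with properPrefix-++ʳ⁻ w {x} {y} (c , z , e′)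
  ... | d , t , refl = d , t , refl

  reverse-nonempty : ∀ (c : A) z → ∃[ d ] ∃[ t ] (reverse (c ∷ z) ≡ d ∷ t)
  reverse-nonempty c z with reverse z | unfold-reverse c z
  ... | []    | e = c , [] , e
  ... | d ∷ t | e = d , t ++ [ c ] , e

  properSuffix⇒properPrefix-reverse : ∀ {x y} → ProperSuffix x y → ProperPrefix (reverse x) (reverse y)
  properSuffix⇒properPrefix-reverse {x} (c , z , refl) with reverse-nonempty c z
  ... | d , t , e = d , t , trans (reverse-++ (c ∷ z) x) (cong (reverse x ++_) e)

  properPrefix-reverse⇒properSuffix : ∀ {x y} → ProperPrefix (reverse x) (reverse y) → ProperSuffix x y
  properPrefix-reverse⇒properSuffix {x} {y} (c , z , e) with reverse-nonempty c z
  ... | d , t , e′ = d , t , (begin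
    y                                   ≡⟨ reverse-involutive y ⟨
    reverse (reverse y)                 ≡⟨ cong reverse e ⟩
    reverse (reverse x ++ c ∷ z)        ≡⟨ reverse-++ (reverse x) (c ∷ z) ⟩
    reverse (c ∷ z) ++ reverse (reverse x) ≡⟨ cong₂ _++_ e′ (reverse-involutive x) ⟩
    (d ∷ t) ++ x                        ∎)
    where open ≡-Reasoning

  properSuffix-++ʳ⁺ : ∀ (w : List A) {x y} → ProperSuffix x y → ProperSuffix (x ++ w) (y ++ w)
  properSuffix-++ʳ⁺ w {x} (c , z , refl) = c , z , ++-assoc (c ∷ z) x w

  properSuffix-++ˡ⁻ : ∀ (w : List A) {x y} → ProperSuffix (w ++ x) (w ++ y) → ProperSuffix x y
  properSuffix-++ˡ⁻ w {x} {y} s = properPrefix-reverse⇒properSuffix (properPrefix-++ʳ⁻ (reverse w)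
    (subst₂ ProperPrefix (reverse-++ w x) (reverse-++ w y) (properSuffix⇒properPrefix-reverse s)))

data LexDiff {A : Set} (R : Rel A 0ℓ) : Rel (List A) 0ℓ where
  here  : ∀ {c d x y} → R c d → LexDiff R (c ∷ x) (d ∷ y)
  there : ∀ {c x y} → LexDiff R x y → LexDiff R (c ∷ x) (c ∷ y)

module _ {A : Set} {R : Rel A 0ℓ} where

  LexDiff-++ : ∀ {x y} u v → LexDiff R x y → LexDiff R (x ++ u) (y ++ v)
  LexDiff-++ u v (here cd) = here cd
  LexDiff-++ u v (there l) = there (LexDiff-++ u v l)

  LexDiff-++ˡ : ∀ w {x y} → LexDiff R x y → LexDiff R (w ++ x) (w ++ y)
  LexDiff-++ˡ []      l = l
  LexDiff-++ˡ (a ∷ w) l = there (LexDiff-++ˡ w l)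

  LexDiff-++ˡ⁻ : Irreflexive _≡_ R → ∀ w {x y} → LexDiff R (w ++ x) (w ++ y) → LexDiff R x y
  LexDiff-++ˡ⁻ irr []      l          = l
  LexDiff-++ˡ⁻ irr (a ∷ w) (here aa)  = ⊥-elim (irr refl aa)
  LexDiff-++ˡ⁻ irr (a ∷ w) (there l)  = LexDiff-++ˡ⁻ irr w l

  LexDiff-irrefl : Irreflexive _≡_ R → Irreflexive _≡_ (LexDiff R)
  LexDiff-irrefl irr refl (here cc)  = irr refl cc
  LexDiff-irrefl irr refl (there l)  = LexDiff-irrefl irr refl l

  LexDiff-trans : Transitive R → Transitive (LexDiff R)
  LexDiff-trans tr (here ab) (here bc)  = here (tr ab bc)
  LexDiff-trans tr (here ab) (there l)  = here ab
  LexDiff-trans tr (there l) (here bc)  = here bc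
  LexDiff-trans tr (there l) (there l′) = there (LexDiff-trans tr l l′)

  data Comparison (x y : List A) : Set where
    lt     : LexDiff R x y → Comparison x y
    eq     : x ≡ y → Comparison x y
    gt     : LexDiff R y x → Comparison x y
    prefix : ProperPrefix x y → Comparison x y
    extension : ProperPrefix y x → Comparison x y

  LexDiff-compare : Trichotomous _≡_ R → ∀ x y → Comparison x y
  LexDiff-compare tri []      []      = eq refl
  LexDiff-compare tri []      (b ∷ y) = prefix (b , y , refl)
  LexDiff-compare tri (a ∷ x) []      = extension (a , x , refl)
  LexDiff-compare tri (a ∷ x) (b ∷ y) with tri a b
  ... | tri< ab _ _ = lt (here ab)
  ... | tri> _ _ ba = gt (here ba)
  ... | tri≈ _ refl _ with LexDiff-compare tri x y
  ... | lt l              = lt (there l)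
  ... | eq e              = eq (cong (a ∷_) e)
  ... | gt l              = gt (there l)
  ... | prefix (c , z , e) = prefix (c , z , cong (a ∷_) e)
  ... | extension (c , z , e) = extension (c , z , cong (a ∷_) e)

module _ {A : Set} {R : Rel A 0ℓ} (sto : IsStrictTotalOrder _≡_ R) where
  private module S = IsStrictTotalOrder sto

  LexDiff-cancelʳ : ∀ {x y} z → ¬ ProperPrefix x y → ¬ ProperPrefix y x →
                    LexDiff R (x ++ z) (y ++ z) → LexDiff R x y
  LexDiff-cancelʳ {x} {y} z x⊀y y⊀x l with LexDiff-compare S.compare x y
  ... | lt l′    = l′
  ... | eq refl  = ⊥-elim (LexDiff-irrefl S.irrefl refl l)
  ... | gt l′    = ⊥-elim (LexDiff-irrefl S.irrefl refl (LexDiff-trans S.trans l (LexDiff-++ z z l′)))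
  ... | prefix p = ⊥-elim (x⊀y p)
  ... | extension p = ⊥-elim (y⊀x p)

  LexDiff-++ʳ⇔ : ∀ z {x y} → ¬ ProperPrefix x y → ¬ ProperPrefix y x → LexDiff R (x ++ z) (y ++ z) ⇔ LexDiff R x y
  LexDiff-++ʳ⇔ z x⊀y y⊀x = mk⇔ (LexDiff-cancelʳ z x⊀y y⊀x) (LexDiff-++ z z)

  LexDiff-++ˡ⇔ : ∀ w {x y} → LexDiff R (w ++ x) (w ++ y) ⇔ LexDiff R x y
  LexDiff-++ˡ⇔ w = mk⇔ (LexDiff-++ˡ⁻ S.irrefl w) (LexDiff-++ˡ w)

  isStrictTotalOrder-via-LexDiff : ∀ {I : Set} (Q : Rel I 0ℓ) (g : I → List A) →
    (∀ {i j} → Q i j ⇔ LexDiff R (g i) (g j)) → (∀ {i j} → g i ≡ g j → i ≡ j) →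
    (∀ {i j} → ¬ ProperPrefix (g i) (g j)) → IsStrictTotalOrder _≡_ Q
  isStrictTotalOrder-via-LexDiff Q g Q⇔ g-inj prefixFree = record
    { isStrictPartialOrder = record
      { isEquivalence = isEquivalence
      ; irrefl        = λ { refl q → irr q }
      ; trans         = λ q q′ → from (LexDiff-trans S.trans (to q) (to q′))
      ; <-resp-≈      = (λ { refl q → q }) , (λ { refl q → q })
      }
    ; compare = cmp
    }
    where
      to : ∀ {i j} → Q i j → LexDiff R (g i) (g j)
      to = Equivalence.to Q⇔
      from : ∀ {i j} → LexDiff R (g i) (g j) → Q i j
      from = Equivalence.from Q⇔
      irr : ∀ {i} → ¬ Q i i
      irr q = LexDiff-irrefl S.irrefl refl (to q)
      cmp : Trichotomous _≡_ Q
      cmp i j with LexDiff-compare S.compare (g i) (g j)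
      ... | lt l      = tri< (from l) (λ { refl → irr (from l) }) (λ q → irr (from (LexDiff-trans S.trans l (to q))))
      ... | eq e with g-inj e
      ...   | refl    = tri≈ irr refl irr
      cmp i j | gt l      = tri> (λ q → irr (from (LexDiff-trans S.trans l (to q)))) (λ { refl → irr (from l) }) (from l)
      cmp i j | prefix p  = ⊥-elim (prefixFree p)
      cmp i j | extension p = ⊥-elim (prefixFree p)

reverse-++-∷ : ∀ {A : Set} (p : List A) c t → reverse (p ++ c ∷ t) ≡ reverse t ++ c ∷ reverse p
reverse-++-∷ p c t = trans (reverse-++ p (c ∷ t))
  (trans (cong (_++ reverse p) (unfold-reverse c t)) (++-assoc (reverse t) [ c ] (reverse p)))

module _ {r : ℕ} {R : Rel (Fin r) 0ℓ} where

  Lex<⇔LexDiff : ∀ {x y} → Lex< R x y ⇔ LexDiff R x y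
  Lex<⇔LexDiff = mk⇔ to from
    where
      to : ∀ {x y} → Lex< R x y → LexDiff R x y
      to (p , c , d , t , t′ , refl , refl , cd) = LexDiff-++ˡ p (here cd)
      from : ∀ {x y} → LexDiff R x y → Lex< R x y
      from (here {c} {d} {x} {y} cd) = [] , c , d , x , y , refl , refl , cd
      from (there {c} l) with from l
      ... | p , a , b , t , t′ , refl , refl , ab = c ∷ p , a , b , t , t′ , refl , refl , ab

  AntiLex<⇔LexDiff-reverse : ∀ {x y} → AntiLex< R x y ⇔ LexDiff R (reverse x) (reverse y)
  AntiLex<⇔LexDiff-reverse = mk⇔ to from
    where
      to : ∀ {x y} → AntiLex< R x y → LexDiff R (reverse x) (reverse y)
      to (p , q , c , d , t , refl , refl , cd) = Equivalence.to Lex<⇔LexDiff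
        (reverse t , c , d , reverse p , reverse q , reverse-++-∷ p c t , reverse-++-∷ q d t , cd)
      from : ∀ {x y} → LexDiff R (reverse x) (reverse y) → AntiLex< R x y
      from {x} {y} l with Equivalence.from Lex<⇔LexDiff l
      ... | p , c , d , t , t′ , ex , ey , cd =
        reverse t , reverse t′ , c , d , reverse p , unreverse x t ex , unreverse y t′ ey , cd
        where
          unreverse : ∀ z {c} t → reverse z ≡ p ++ c ∷ t → z ≡ reverse t ++ c ∷ reverse p
          unreverse z {c} t e = trans (sym (reverse-involutive z)) (trans (cong reverse e) (reverse-++-∷ p c t))

subst₂-⇔ : ∀ {A : Set} (P : Rel A 0ℓ) {x x′ y y′} → x ≡ x′ → y ≡ y′ → P x y ⇔ P x′ y′
subst₂-⇔ P refl refl = mk⇔ id id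

module _ {r : ℕ} {R : Rel (Fin r) 0ℓ} (sto : IsStrictTotalOrder _≡_ R) where

  Lex<-++ʳ⇔ : ∀ z {x y} → ¬ ProperPrefix x y → ¬ ProperPrefix y x → Lex< R (x ++ z) (y ++ z) ⇔ Lex< R x y
  Lex<-++ʳ⇔ z x⊀y y⊀x = ⇔-sym Lex<⇔LexDiff ⇔-∘ (LexDiff-++ʳ⇔ sto z x⊀y y⊀x ⇔-∘ Lex<⇔LexDiff)

  Lex<-++ˡ⇔ : ∀ w {x y} → Lex< R (w ++ x) (w ++ y) ⇔ Lex< R x y
  Lex<-++ˡ⇔ w = ⇔-sym Lex<⇔LexDiff ⇔-∘ (LexDiff-++ˡ⇔ sto w ⇔-∘ Lex<⇔LexDiff)

  AntiLex<-++ʳ⇔ : ∀ w {x y} → AntiLex< R (x ++ w) (y ++ w) ⇔ AntiLex< R x y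
  AntiLex<-++ʳ⇔ w {x} {y} = ⇔-sym AntiLex<⇔LexDiff-reverse ⇔-∘ (LexDiff-++ˡ⇔ sto (reverse w)
    ⇔-∘ (subst₂-⇔ (LexDiff R) (reverse-++ x w) (reverse-++ y w) ⇔-∘ AntiLex<⇔LexDiff-reverse))

  AntiLex<-++ˡ⇔ : ∀ w {x y} → ¬ ProperSuffix x y → ¬ ProperSuffix y x → AntiLex< R (w ++ x) (w ++ y) ⇔ AntiLex< R x y
  AntiLex<-++ˡ⇔ w {x} {y} x⊀y y⊀x = ⇔-sym AntiLex<⇔LexDiff-reverse
    ⇔-∘ (LexDiff-++ʳ⇔ sto (reverse w) (x⊀y ∘ properPrefix-reverse⇒properSuffix) (y⊀x ∘ properPrefix-reverse⇒properSuffix)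
    ⇔-∘ (subst₂-⇔ (LexDiff R) (reverse-++ w x) (reverse-++ w y) ⇔-∘ AntiLex<⇔LexDiff-reverse))

window : ∀ {A : Set} → (ℕ → A) → ℕ → ℕ → List A
window T p zero    = []
window T p (suc l) = T p ∷ window T (suc p) l

module _ {A : Set} (T : ℕ → A) where

  length-window : ∀ p l → length (window T p l) ≡ l
  length-window p zero    = refl
  length-window p (suc l) = cong suc (length-window (suc p) l)

  window-+ : ∀ p a b → window T p (a + b) ≡ window T p a ++ window T (p + a) b
  window-+ p zero    b = cong (λ z → window T z b) (sym (+-identityʳ p))
  window-+ p (suc a) b = cong (T p ∷_)
    (trans (window-+ (suc p) a b) (cong (λ z → window T (suc p) a ++ window T z b) (sym (+-suc p a))))

  take-window : ∀ p {a l} → a ≤ l → take a (window T p l) ≡ window T p a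
  take-window p {zero}           _       = refl
  take-window p {suc a} {suc l} (s≤s h) = cong (T p ∷_) (take-window (suc p) h)

  drop-window : ∀ p a l → drop a (window T p l) ≡ window T (p + a) (l ∸ a)
  drop-window p zero    l       = cong (λ z → window T z l) (sym (+-identityʳ p))
  drop-window p (suc a) zero    = refl
  drop-window p (suc a) (suc l) = trans (drop-window (suc p) a l) (cong (λ z → window T z (l ∸ a)) (sym (+-suc p a)))

  window-∷-index : ∀ p l X {c Y} → window T p l ≡ X ++ c ∷ Y → T (p + length X) ≡ c
  window-∷-index p (suc l) []      e = trans (cong T (+-identityʳ p)) (proj₁ (∷-injective e))
  window-∷-index p (suc l) (x ∷ X) e =
    trans (cong T (+-suc p (length X))) (window-∷-index (suc p) l X (proj₂ (∷-injective e)))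

  window-split : ∀ a l p → a ≤ p → p < a + l →
                 window T a l ≡ window T a (p ∸ a) ++ T p ∷ window T (suc p) (a + l ∸ suc p)
  window-split a l p a≤p p<a+l = begin
    window T a l                                  ≡⟨ cong (window T a) l≡ ⟩
    window T a ((p ∸ a) + suc (a + l ∸ suc p))    ≡⟨ window-+ a (p ∸ a) _ ⟩
    window T a (p ∸ a) ++ window T (a + (p ∸ a)) (suc (a + l ∸ suc p))
      ≡⟨ cong (λ z → window T a (p ∸ a) ++ window T z (suc (a + l ∸ suc p))) (m+[n∸m]≡n a≤p) ⟩
    window T a (p ∸ a) ++ T p ∷ window T (suc p) (a + l ∸ suc p) ∎
    where
      open ≡-Reasoning
      l≡ : l ≡ (p ∸ a) + suc (a + l ∸ suc p)
      l≡ = +-cancelˡ-≡ a l _ (begin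
        a + l                                 ≡⟨ m+[n∸m]≡n p<a+l ⟨
        suc p + (a + l ∸ suc p)               ≡⟨ cong (λ z → suc z + (a + l ∸ suc p)) (m+[n∸m]≡n a≤p) ⟨
        suc (a + (p ∸ a)) + (a + l ∸ suc p)   ≡⟨ cong suc (+-assoc a (p ∸ a) _) ⟩
        suc (a + ((p ∸ a) + (a + l ∸ suc p))) ≡⟨ +-suc a _ ⟨
        a + suc ((p ∸ a) + (a + l ∸ suc p))   ≡⟨ cong (a +_) (+-suc (p ∸ a) _) ⟨
        a + ((p ∸ a) + suc (a + l ∸ suc p))   ∎)

  window-infix : ∀ a₀ L a l → a₀ ≤ a → a + l ≤ a₀ + L → ∃[ X ] ∃[ Y ] (window T a₀ L ≡ X ++ window T a l ++ Y)
  window-infix a₀ L a l a₀≤a end≤ = window T a₀ (a ∸ a₀) , window T (a + l) d , (begin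
    window T a₀ L                                           ≡⟨ cong (window T a₀) L≡ ⟩
    window T a₀ ((a ∸ a₀) + (l + d))                        ≡⟨ window-+ a₀ (a ∸ a₀) (l + d) ⟩
    window T a₀ (a ∸ a₀) ++ window T (a₀ + (a ∸ a₀)) (l + d) ≡⟨ cong (λ z → window T a₀ (a ∸ a₀) ++ window T z (l + d)) (m+[n∸m]≡n a₀≤a) ⟩
    window T a₀ (a ∸ a₀) ++ window T a (l + d)              ≡⟨ cong (_ ++_) (window-+ a l d) ⟩
    window T a₀ (a ∸ a₀) ++ window T a l ++ window T (a + l) d ∎)
    where
      open ≡-Reasoning
      d = (a₀ + L) ∸ (a + l)
      L≡ : L ≡ (a ∸ a₀) + (l + d)
      L≡ = +-cancelˡ-≡ a₀ L _ (begin
        a₀ + L                    ≡⟨ m+[n∸m]≡n end≤ ⟨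
        a + l + d                 ≡⟨ cong (λ z → z + l + d) (m+[n∸m]≡n a₀≤a) ⟨
        a₀ + (a ∸ a₀) + l + d     ≡⟨ trans (+-assoc (a₀ + (a ∸ a₀)) l d) (+-assoc a₀ (a ∸ a₀) (l + d)) ⟩
        a₀ + ((a ∸ a₀) + (l + d)) ∎)

  window-prefix : ∀ p l M Z → window T p l ≡ M ++ Z → window T p (length M) ≡ M
  window-prefix p l M Z e = trans (sym (take-window p |M|≤l)) (trans (cong (take (length M)) e) (take-length-++ M Z))
    where
      |M|≤l : length M ≤ l
      |M|≤l = subst (length M ≤_) (trans (sym (length-++ M)) (trans (cong length (sym e)) (length-window p l))) (m≤m+n _ _)

  window-∷-++-∷ : ∀ a l X {d} M {y} Z → window T a l ≡ X ++ d ∷ M ++ y ∷ Z →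
                  T (a + length X) ≡ d × window T (suc (a + length X)) (length M) ≡ M × T (suc (a + length X) + length M) ≡ y
  window-∷-++-∷ a l X {d} M {y} Z e =
    window-∷-index a l X e , window-prefix _ _ M (y ∷ Z) rest , window-∷-index _ _ M rest
    where
      rest : window T (suc (a + length X)) (l ∸ suc (length X)) ≡ M ++ y ∷ Z
      rest = trans (cong (λ z → window T z (l ∸ suc (length X))) (sym (+-suc a (length X))))
               (trans (sym (drop-window a (suc (length X)) l)) (trans (cong (drop (suc (length X))) e) (drop-suc-length X d _)))

module _ {A : Set} where

  window-cong : ∀ (T U : ℕ → A) p q l → (∀ i → i < l → T (p + i) ≡ U (q + i)) → window T p l ≡ window U q l
  window-cong T U p q zero    h = refl
  window-cong T U p q (suc l) h = cong₂ _∷_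
    (trans (cong T (sym (+-identityʳ p))) (trans (h 0 (s≤s z≤n)) (cong U (+-identityʳ q))))
    (window-cong T U (suc p) (suc q) l λ i i<l →
      trans (cong T (sym (+-suc p i))) (trans (h (suc i) (s≤s i<l)) (cong U (+-suc q i))))

  window-injective : ∀ (T U : ℕ → A) p q l → window T p l ≡ window U q l → ∀ i → i < l → T (p + i) ≡ U (q + i)
  window-injective T U p q (suc l) e zero    _       =
    trans (cong T (+-identityʳ p)) (trans (proj₁ (∷-injective e)) (cong U (sym (+-identityʳ q))))
  window-injective T U p q (suc l) e (suc i) (s≤s h) =
    trans (cong T (+-suc p i)) (trans (window-injective T U (suc p) (suc q) l (proj₂ (∷-injective e)) i h)
                                      (cong U (sym (+-suc q i))))

module _ {A : Set} {R : Rel A 0ℓ} where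

  LexDiff-∷⁻ : ∀ {a b x y} → LexDiff R (a ∷ x) (b ∷ y) → R a b ⊎ (a ≡ b × LexDiff R x y)
  LexDiff-∷⁻ (here ab) = inj₁ ab
  LexDiff-∷⁻ (there l) = inj₂ (refl , l)

  LexDiff-window⁺ : ∀ (T : ℕ → A) p q {k l l′} → k < l → k < l′ → (∀ m → m < k → T (p + m) ≡ T (q + m)) →
                    R (T (p + k)) (T (q + k)) → LexDiff R (window T p l) (window T q l′)
  LexDiff-window⁺ T p q {zero} {suc l} {suc l′} _ _ _ differ =
    here (subst₂ R (cong T (+-identityʳ p)) (cong T (+-identityʳ q)) differ)
  LexDiff-window⁺ T p q {suc k} {suc l} {suc l′} (s≤s k<l) (s≤s k<l′) agree differ =
    subst (λ a → LexDiff R (T p ∷ window T (suc p) l) (a ∷ window T (suc q) l′)) Tp≡Tq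
      (there (LexDiff-window⁺ T (suc p) (suc q) k<l k<l′
        (λ m m<k → trans (cong T (sym (+-suc p m))) (trans (agree (suc m) (s≤s m<k)) (cong T (+-suc q m))))
        (subst₂ R (cong T (+-suc p k)) (cong T (+-suc q k)) differ)))
    where
      Tp≡Tq : T p ≡ T q
      Tp≡Tq = trans (cong T (sym (+-identityʳ p))) (trans (agree 0 (s≤s z≤n)) (cong T (+-identityʳ q)))

  LexDiff-window⁻ : ∀ (T : ℕ → A) p q l → LexDiff R (window T p l) (window T q l) →
                    ∃[ k ] (k < l × (∀ m → m < k → T (p + m) ≡ T (q + m)) × R (T (p + k)) (T (q + k)))
  LexDiff-window⁻ T p q (suc l) d with LexDiff-∷⁻ d
  ... | inj₁ differ = 0 , s≤s z≤n , (λ _ ()) , subst₂ R (cong T (sym (+-identityʳ p))) (cong T (sym (+-identityʳ q))) differ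
  ... | inj₂ (Tp≡Tq , d′) with LexDiff-window⁻ T (suc p) (suc q) l d′
  ...   | k , k<l , agree , differ =
    suc k , s≤s k<l , agree′ , subst₂ R (cong T (sym (+-suc p k))) (cong T (sym (+-suc q k))) differ
    where
      agree′ : ∀ m → m < suc k → T (p + m) ≡ T (q + m)
      agree′ zero    _         = trans (cong T (+-identityʳ p)) (trans Tp≡Tq (cong T (sym (+-identityʳ q))))
      agree′ (suc m) (s≤s m<k) = trans (cong T (+-suc p m)) (trans (agree m m<k) (cong T (sym (+-suc q m))))

module _ {r : ℕ} (w : Word r) where

  OccursAt : Word r → ℕ → Set
  OccursAt u i = take (length w) (drop i u) ≡ w

  occursAt-infix : ∀ X Y → OccursAt (X ++ w ++ Y) (length X)
  occursAt-infix X Y = trans (cong (take (length w)) (drop-length-++ X (w ++ Y))) (take-length-++ w Y)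

  module _ (u : Word r) where
    private
      occurs? : ∀ i → Dec (OccursAt u i)
      occurs? i = ≡-dec _≟_ (take (length w) (drop i u)) w

      occurrencesBelow : ℕ → ℕ
      occurrencesBelow n = length (filter occurs? (upTo n))

      occurrencesBelow-suc : ∀ n → occurrencesBelow (suc n) ≡ occurrencesBelow n + length (filter occurs? [ n ])
      occurrencesBelow-suc n = trans (cong (λ ns → length (filter occurs? ns)) (sym (upTo-∷ʳ n)))
        (trans (cong length (filter-++ occurs? (upTo n) [ n ])) (length-++ (filter occurs? (upTo n))))

      occurrencesBelow-+ : ∀ n d → occurrencesBelow n ≤ occurrencesBelow (d + n)
      occurrencesBelow-+ n zero    = ≤-refl
      occurrencesBelow-+ n (suc d) = ≤-trans (occurrencesBelow-+ n d)
        (≤-trans (m≤m+n _ _) (≤-reflexive (sym (occurrencesBelow-suc (d + n)))))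

      occurrencesBelow-mono : ∀ {m n} → m ≤ n → occurrencesBelow m ≤ occurrencesBelow n
      occurrencesBelow-mono {m} {n} m≤n =
        subst (λ z → occurrencesBelow m ≤ occurrencesBelow z) (m∸n+n≡m m≤n) (occurrencesBelow-+ m (n ∸ m))

      occurrencesBelow-hit : ∀ n → OccursAt u n → suc (occurrencesBelow n) ≤ occurrencesBelow (suc n)
      occurrencesBelow-hit n o = ≤-reflexive (sym (trans (occurrencesBelow-suc n)
        (trans (cong (λ z → occurrencesBelow n + length z) (filter-accept occurs? o)) (+-comm _ 1))))

    three-occurrences : ∀ {a b c} → a < b → b < c → c ≤ length u ∸ length w →
                        OccursAt u a → OccursAt u b → OccursAt u c → 3 ≤ occurrences w u
    three-occurrences a<b b<c c≤ oa ob oc =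
      step oc (s≤s c≤) (step ob b<c (step oa a<b z≤n))
      where
        step : ∀ {k i j} → OccursAt u i → suc i ≤ j → k ≤ occurrencesBelow i → suc k ≤ occurrencesBelow j
        step o i<j k≤ = ≤-trans (s≤s k≤) (≤-trans (occurrencesBelow-hit _ o) (occurrencesBelow-mono i<j))

  occurrences-short : ∀ x → length x ≤ length w → occurrences w x ≤ 1
  occurrences-short x x≤w rewrite m≤n⇒m∸n≡0 x≤w = length-filter (λ i → ≡-dec _≟_ (take (length w) (drop i x)) w) [ 0 ]

  twoOccurrences⇒longer : ∀ x → occurrences w x ≡ 2 → length w < length x
  twoOccurrences⇒longer x two = ≰⇒> λ x≤w → 1+n≰n (subst (_≤ 1) two (occurrences-short x x≤w))

  noInteriorOccurrence : ∀ ψ → occurrences w (w ++ ψ) ≡ 2 → IsSuffix w (w ++ ψ) →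
                         ∀ {o} → 0 < o → o < length ψ → ¬ OccursAt (w ++ ψ) o
  noInteriorOccurrence ψ two (P , P++w≡w++ψ) 0<o o<ψ occ = 1+n≰n (subst (3 ≤_) two
    (three-occurrences (w ++ ψ) 0<o o<ψ ψ≤ (occursAt-infix [] ψ) occ
      (subst (OccursAt (w ++ ψ)) |P|≡|ψ| (subst (λ z → OccursAt z (length P)) w++ψ≡ (occursAt-infix P [])))))
    where
      ψ≤ : length ψ ≤ length (w ++ ψ) ∸ length w
      ψ≤ = ≤-reflexive (sym (trans (cong (_∸ length w) (length-++ w)) (m+n∸m≡n (length w) (length ψ))))
      w++ψ≡ : P ++ w ++ [] ≡ w ++ ψ
      w++ψ≡ = trans (cong (P ++_) (++-identityʳ w)) P++w≡w++ψ
      |P|≡|ψ| : length P ≡ length ψ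
      |P|≡|ψ| = +-cancelʳ-≡ (length w) (length P) (length ψ)
        (trans (sym (length-++ P)) (trans (cong length P++w≡w++ψ) (trans (length-++ w) (+-comm (length w) (length ψ)))))

record SuffixReturnFamily {r s : ℕ} (L : Language r) (w : Word r) (ψ : Fin s → Word r) : Set where
  field
    inL            : ∀ i → L (w ++ ψ i)
    twoOccurrences : ∀ i → occurrences w (w ++ ψ i) ≡ 2
    endsWith       : ∀ i → IsSuffix w (w ++ ψ i)
    injective      : ∀ {i j} → ψ i ≡ ψ j → i ≡ j

  nonempty : ∀ i → 0 < length (ψ i)
  nonempty i = +-cancelˡ-< (length w) 0 (length (ψ i))
    (subst₂ _<_ (sym (+-identityʳ (length w))) (length-++ w) (twoOccurrences⇒longer w _ (twoOccurrences i)))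

  ¬properPrefix : ∀ {i j} → ¬ ProperPrefix (ψ i) (ψ j)
  ¬properPrefix {i} {j} (c , z , ψj≡) with endsWith i
  ... | P , P++w≡w++ψi = noInteriorOccurrence w (ψ j) (twoOccurrences j) (endsWith j) 0<|P| |P|<|ψj|
        (subst (λ u → OccursAt w u (length P)) (sym w++ψj≡) (occursAt-infix w P (c ∷ z)))
    where
      w++ψj≡ : w ++ ψ j ≡ P ++ w ++ c ∷ z
      w++ψj≡ = trans (cong (w ++_) ψj≡) (trans (sym (++-assoc w (ψ i) _))
                 (trans (cong (_++ c ∷ z) (sym P++w≡w++ψi)) (++-assoc P w _)))
      |P|≡|ψi| : length P ≡ length (ψ i)
      |P|≡|ψi| = +-cancelʳ-≡ (length w) _ _ (trans (sym (length-++ P))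
        (trans (cong length P++w≡w++ψi) (trans (length-++ w) (+-comm (length w) _))))
      0<|P| : 0 < length P
      0<|P| = subst (0 <_) (sym |P|≡|ψi|) (nonempty i)
      |P|<|ψj| : length P < length (ψ j)
      |P|<|ψj| = subst₂ _<_ (sym |P|≡|ψi|) (sym (trans (cong length ψj≡) (length-++ (ψ i)))) (m<m+n _ (s≤s z≤n))

  ¬properSuffix : ∀ {i j} → ¬ ProperSuffix (w ++ ψ i) (w ++ ψ j)
  ¬properSuffix {i} {j} (c , z , w++ψj≡) = noInteriorOccurrence w (ψ j) (twoOccurrences j) (endsWith j)
    (s≤s z≤n) |cz|<|ψj| (subst (λ u → OccursAt w u (length (c ∷ z))) (sym w++ψj≡) (occursAt-infix w (c ∷ z) (ψ i)))
    where
      |ψj|≡ : length (ψ j) ≡ length (c ∷ z) + length (ψ i)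
      |ψj|≡ = +-cancelˡ-≡ (length w) _ _ (begin
        length w + length (ψ j)                        ≡⟨ length-++ w ⟨
        length (w ++ ψ j)                              ≡⟨ cong length w++ψj≡ ⟩
        length ((c ∷ z) ++ w ++ ψ i)                   ≡⟨ trans (length-++ (c ∷ z)) (cong (length (c ∷ z) +_) (length-++ w)) ⟩
        length (c ∷ z) + (length w + length (ψ i))     ≡⟨ +-assoc (length (c ∷ z)) _ _ ⟨
        length (c ∷ z) + length w + length (ψ i)       ≡⟨ cong (_+ length (ψ i)) (+-comm (length (c ∷ z)) _) ⟩
        length w + length (c ∷ z) + length (ψ i)       ≡⟨ +-assoc (length w) _ _ ⟩
        length w + (length (c ∷ z) + length (ψ i))     ∎)
        where open ≡-Reasoning
      |cz|<|ψj| : length (c ∷ z) < length (ψ j)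
      |cz|<|ψj| = subst (length (c ∷ z) <_) (sym |ψj|≡) (m<m+n _ (nonempty i))

nth : ∀ {A : Set} → List A → ℕ → A → A
nth []       n       d = d
nth (x ∷ xs) zero    d = x
nth (x ∷ xs) (suc n) d = nth xs n d

module _ {A : Set} where

  drop-nth : ∀ (xs : List A) p d → p < length xs → drop p xs ≡ nth xs p d ∷ drop (suc p) xs
  drop-nth (x ∷ xs) zero    d _       = refl
  drop-nth (x ∷ xs) (suc p) d (s≤s h) = drop-nth xs p d h

  window-nth : ∀ (xs : List A) d p l → p + l ≤ length xs → window (λ k → nth xs k d) p l ≡ take l (drop p xs)
  window-nth xs d p zero    _ = refl
  window-nth xs d p (suc l) h = trans
    (cong (nth xs p d ∷_) (window-nth xs d (suc p) l (subst (_≤ length xs) (+-suc p l) h)))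
    (cong (take (suc l)) (sym (drop-nth xs p d (<-≤-trans (m<m+n p (s≤s z≤n)) h))))

  take-suc-nth : ∀ (xs : List A) k d → k < length xs → take (suc k) xs ≡ take k xs ++ [ nth xs k d ]
  take-suc-nth (x ∷ xs) zero    d _       = refl
  take-suc-nth (x ∷ xs) (suc k) d (s≤s h) = cong (x ∷_) (take-suc-nth xs k d h)

  applyUpTo-nth : ∀ (xs : List A) d → applyUpTo (λ i → nth xs i d) (length xs) ≡ xs
  applyUpTo-nth []       d = refl
  applyUpTo-nth (x ∷ xs) d = cong (x ∷_) (applyUpTo-nth xs d)

lastOr : ∀ {A : Set} → A → List A → A
lastOr d []           = d
lastOr d (x ∷ [])     = x
lastOr d (x ∷ y ∷ ys) = lastOr d (y ∷ ys)

last≡lastOr : ∀ {A : Set} (d : A) x n → length x ≡ suc n → last x ≡ just (lastOr d x)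
last≡lastOr d (x ∷ [])     n       e = refl
last≡lastOr d (x ∷ y ∷ ys) (suc n) e = last≡lastOr d (y ∷ ys) n (cong pred e)

lastOr-window : ∀ {A : Set} (d : A) T p l → lastOr d (window T p (suc l)) ≡ T (p + l)
lastOr-window d T p zero    = cong T (sym (+-identityʳ p))
lastOr-window d T p (suc l) = trans (lastOr-window d T (suc p) l) (cong T (sym (+-suc p l)))

module Periodic {r : ℕ} (c : Fin r) (u′ : Word r) where

  u : Word r
  u = c ∷ u′

  N : ℕ
  N = suc (length u′)

  T : ℕ → Fin r
  T p = nth u (p % N) c

  T-periodic : ∀ x k → T (x + k * N) ≡ T x
  T-periodic x k = cong (λ z → nth u z c) ([m+kn]%n≡m%n x k N)

  T-+N : ∀ x → T (x + N) ≡ T x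
  T-+N x = cong (λ z → nth u z c) ([m+n]%n≡m%n x N)

  window-T : ∀ p l → p + l ≤ N → window T p l ≡ take l (drop p u)
  window-T p l h = trans
    (window-cong T (λ k → nth u k c) p p l (λ i i<l → cong (λ z → nth u z c) (m<n⇒m%n≡m (<-≤-trans (+-monoʳ-< p i<l) h))))
    (window-nth u c p l h)

  conjugate≡window : ∀ i → i < N → drop i u ++ take i u ≡ window T i N
  conjugate≡window i i<N = begin
    drop i u ++ take i u                         ≡⟨ cong₂ _++_ drop≡ take≡ ⟩
    window T i (N ∸ i) ++ window T (i + (N ∸ i)) i ≡⟨ window-+ T i (N ∸ i) i ⟨
    window T i ((N ∸ i) + i)                     ≡⟨ cong (window T i) (m∸n+n≡m (<⇒≤ i<N)) ⟩
    window T i N                                 ∎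
    where
      open ≡-Reasoning
      drop≡ : drop i u ≡ window T i (N ∸ i)
      drop≡ = trans (sym (take-all (N ∸ i) (drop i u) (≤-reflexive (length-drop i u))))
                    (sym (window-T i (N ∸ i) (≤-reflexive (m+[n∸m]≡n (<⇒≤ i<N)))))
      take≡ : take i u ≡ window T (i + (N ∸ i)) i
      take≡ = trans (sym (window-T 0 i (<⇒≤ i<N)))
        (trans (window-cong T T 0 N i (λ j _ → sym (trans (cong T (+-comm N j)) (T-+N j))))
               (cong (λ z → window T z i) (sym (m+[n∸m]≡n (<⇒≤ i<N)))))

  T-% : ∀ x m → T (x % N + m) ≡ T (x + m)
  T-% x m = trans (sym (T-periodic (x % N + m) (x / N))) (cong T (begin
    x % N + m + x / N * N   ≡⟨ +-assoc (x % N) m _ ⟩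
    x % N + (m + x / N * N) ≡⟨ cong (x % N +_) (+-comm m _) ⟩
    x % N + (x / N * N + m) ≡⟨ +-assoc (x % N) _ m ⟨
    x % N + x / N * N + m   ≡⟨ cong (_+ m) (m≡m%n+[m/n]*n x N) ⟨
    x + m                   ∎))
    where open ≡-Reasoning

  T-+% : ∀ x k → T (x + k % N) ≡ T (x + k)
  T-+% x k = trans (sym (T-periodic (x + k % N) (k / N)))
    (cong T (trans (+-assoc x (k % N) _) (cong (x +_) (sym (m≡m%n+[m/n]*n k N)))))

  T-+n : ∀ x → T (suc x + length u′) ≡ T x
  T-+n x = trans (cong T (sym (+-suc x (length u′)))) (T-+N x)

  T-+*N : ∀ i m B → T (suc (i + length u′ + B * N) + m) ≡ T (i + m)
  T-+*N i m B = trans (cong T (solve 4 (λ i m n B → con 1 :+ (i :+ n :+ B :* (con 1 :+ n)) :+ m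
                                               := (i :+ m) :+ (con 1 :+ B) :* (con 1 :+ n)) refl i m (length u′) B))
                      (T-periodic (i + m) (suc B))
    where open +-*-Solver

  window∈conjugates : ∀ {i} → i < N → window T i N ∈ conjugates u
  window∈conjugates {i} i<N =
    subst (_∈ conjugates u) (conjugate≡window i i<N) (∈-map⁺ (λ i → drop i u ++ take i u) (∈-upTo⁺ i<N))

  ∈conjugates⇒window : ∀ {x} → x ∈ conjugates u → ∃[ i ] (i < N × x ≡ window T i N)
  ∈conjugates⇒window x∈ with ∈-map⁻ (λ i → drop i u ++ take i u) x∈
  ... | i , i∈ , refl = i , ∈-upTo⁻ i∈ , conjugate≡window i (∈-upTo⁻ i∈)

  lastOr-conjugates-↭ : map (lastOr c) (conjugates u) ↭ u
  lastOr-conjugates-↭ = ↭-trans (↭-reflexive lasts≡) (↭-trans (∷↭∷ʳ (T n) (applyUpTo T n)) (↭-reflexive u≡))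
    where
      open ≡-Reasoning
      n = length u′
      lasts≡ : map (lastOr c) (conjugates u) ≡ T n ∷ applyUpTo T n
      lasts≡ = begin
        map (lastOr c) (conjugates u)                       ≡⟨ map-∘ (upTo N) ⟨
        map (λ i → lastOr c (drop i u ++ take i u)) (upTo N) ≡⟨ map-cong-local (All.applyUpTo⁺₁ (λ i → i) N λ i<N →
                                                                   trans (cong (lastOr c) (conjugate≡window _ i<N)) (lastOr-window c T _ n)) ⟩
        map (λ i → T (i + n)) (upTo N)                      ≡⟨ map-upTo _ N ⟩
        T n ∷ applyUpTo (λ i → T (suc i + n)) n            ≡⟨ cong (T n ∷_) (trans (sym (map-upTo _ n))
                                                               (trans (map-cong (λ i → trans (cong T (sym (+-suc i n))) (T-+N i)) (upTo n)) (map-upTo T n))) ⟩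
        T n ∷ applyUpTo T n                                 ∎
      u≡ : applyUpTo T n ∷ʳ T n ≡ u
      u≡ = begin
        applyUpTo T n ∷ʳ T n       ≡⟨ applyUpTo-∷ʳ T n ⟩
        applyUpTo T N              ≡⟨ map-upTo T N ⟨
        map T (upTo N)             ≡⟨ map-cong-local (All.applyUpTo⁺₁ (λ i → i) N λ {i} i<N → cong (λ z → nth u z c) (m<n⇒m%n≡m i<N)) ⟩
        map (λ i → nth u i c) (upTo N) ≡⟨ map-upTo _ N ⟩
        applyUpTo (λ i → nth u i c) N ≡⟨ applyUpTo-nth u c ⟩
        u                          ∎

allPairs-∈ : ∀ {A : Set} {R : Rel A 0ℓ} {xs x y} → AllPairs R xs → x ∈ xs → y ∈ xs → x ≡ y ⊎ R x y ⊎ R y x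
allPairs-∈ (_ ∷ _)  (here refl) (here refl) = inj₁ refl
allPairs-∈ (Rx ∷ _) (here refl) (there y∈)  = inj₂ (inj₁ (All-lookup Rx y∈))
allPairs-∈ (Rx ∷ _) (there x∈)  (here refl) = inj₂ (inj₂ (All-lookup Rx x∈))
allPairs-∈ (_ ∷ ap) (there x∈)  (there y∈)  = allPairs-∈ ap x∈ y∈

clustered : ∀ {r} → List (Fin r) → Word r → Word r
clustered cs u = concatMap (λ c → replicate (count c u) c) cs

clustered-[] : ∀ {r} (cs : List (Fin r)) → clustered cs [] ≡ []
clustered-[] []       = refl
clustered-[] (c ∷ cs) = clustered-[] cs

count-∷-≢ : ∀ {r} {c x : Fin r} u → c ≢ x → count c (x ∷ u) ≡ count c u
count-∷-≢ {c = c} u c≢x = cong length (filter-reject (c ≟_) c≢x)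

count-∷-≡ : ∀ {r} (x : Fin r) u → count x (x ∷ u) ≡ suc (count x u)
count-∷-≡ x u = cong length (filter-accept (x ≟_) refl)

clustered-∷-∉ : ∀ {r} {x : Fin r} {ds} u → All (_≢ x) ds → clustered ds (x ∷ u) ≡ clustered ds u
clustered-∷-∉ u []            = refl
clustered-∷-∉ u (d≢x ∷ d∉)    = cong₂ _++_ (cong (λ n → replicate n _) (count-∷-≢ u d≢x)) (clustered-∷-∉ u d∉)

unique-split : ∀ {A : Set} {x : A} pre {post} → Unique.Unique (pre ++ x ∷ post) → All (_≢ x) pre × All (_≢ x) post
unique-split []        (x≢ ∷ _)    = [] , All-map (λ x≢y y≡x → x≢y (sym y≡x)) x≢
unique-split (p ∷ pre) (p≢ ∷ rest) with All.++⁻ pre p≢ | unique-split pre rest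
... | _ , (p≢x ∷ _) | pre≢ , post≢ = p≢x ∷ pre≢ , post≢

clustered-↭ : ∀ {r} (cs : List (Fin r)) → Unique.Unique cs → (∀ x → x ∈ cs) → ∀ u → u ↭ clustered cs u
clustered-↭ cs unique complete []      = ↭-reflexive (sym (clustered-[] cs))
clustered-↭ cs unique complete (x ∷ u) with ∈-∃++ (complete x)
... | pre , post , refl with unique-split pre unique
... | pre≢ , post≢ = ↭-sym (begin
  clustered (pre ++ x ∷ post) (x ∷ u)              ≡⟨ concatMap-++ _ pre (x ∷ post) ⟩
  clustered pre (x ∷ u) ++ clustered (x ∷ post) (x ∷ u)
    ≡⟨ cong₂ _++_ (clustered-∷-∉ u pre≢) (cong₂ _++_ (cong (λ n → replicate n x) (count-∷-≡ x u)) (clustered-∷-∉ u post≢)) ⟩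
  clustered pre u ++ x ∷ clustered (x ∷ post) u    ↭⟨ shift x (clustered pre u) _ ⟩
  x ∷ clustered pre u ++ clustered (x ∷ post) u    ≡⟨ cong (x ∷_) (concatMap-++ _ pre (x ∷ post)) ⟨
  x ∷ clustered (pre ++ x ∷ post) u               ↭⟨ ↭-prep x (↭-sym (clustered-↭ (pre ++ x ∷ post) unique complete u)) ⟩
  x ∷ u                                           ∎)
  where open PermutationReasoning

Linked-map-All : ∀ {A B : Set} {P : A → Set} {R : Rel A 0ℓ} {S : Rel B 0ℓ} (f : A → B) →
                 (∀ {x y} → P x → P y → R x y → S (f x) (f y)) → ∀ {xs} → Linked R xs → All P xs → Linked S (map f xs)
Linked-map-All f step []          _                = []
Linked-map-All f step [-]         _                = [-]
Linked-map-All f step (Rxy ∷ Rys) (Px ∷ Py ∷ Pys) = step Px Py Rxy ∷ Linked-map-All f step Rys (Py ∷ Pys)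

-- The stream analogue of an unsorted pair in a BWT: the suffix after p is <D-smaller than the
-- suffix after q, but the letter T p preceding it is <A-larger than T q.
record Inversion {r : ℕ} (T : ℕ → Fin r) (_<A_ _<D_ : Rel (Fin r) 0ℓ) (B : ℕ) : Set where
  field
    p q k    : ℕ
    B≤p      : B ≤ p
    B≤q      : B ≤ q
    agree    : ∀ m → m < k → T (suc p + m) ≡ T (suc q + m)
    differ   : T (suc p + k) <D T (suc q + k)
    inverted : T q <A T p

InversionFree : ∀ {r : ℕ} → (ℕ → Fin r) → Rel (Fin r) 0ℓ → Rel (Fin r) 0ℓ → ℕ → Set
InversionFree T _<A_ _<D_ B = ¬ Inversion T _<A_ _<D_ B

module _ {r : ℕ} {_<A_ _<D_ : Rel (Fin r) 0ℓ}
         (stoA : IsStrictTotalOrder _≡_ _<A_) (stoD : IsStrictTotalOrder _≡_ _<D_) where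

  private
    module SA = IsStrictTotalOrder stoA
    module SD = IsStrictTotalOrder stoD
    module ≤A = StrictToNonStrict _≡_ _<A_
    _≤A_ = ≤A._≤_

    ≤A⇒≯ : ∀ {a b} → a ≤A b → ¬ b <A a
    ≤A⇒≯ (inj₁ a<b)  b<a = SA.asym a<b b<a
    ≤A⇒≯ (inj₂ refl) a<a = SA.irrefl refl a<a

    LexDiff⇒≱ : ∀ {x y} → LexDiff _<D_ x y → ¬ Lex-≤ _≡_ _<D_ y x
    LexDiff⇒≱ (here c<d) (this d<c)     = SD.asym c<d d<c
    LexDiff⇒≱ (here c<d) (next refl _)  = SD.irrefl refl c<d
    LexDiff⇒≱ (there l)  (this c<c)     = SD.irrefl refl c<c
    LexDiff⇒≱ (there l)  (next _ l′)    = LexDiff⇒≱ l l′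

    Lex-≤-sameLength : ∀ {x y} → length x ≡ length y → Lex-≤ _≡_ _<D_ x y → x ≡ y ⊎ LexDiff _<D_ x y
    Lex-≤-sameLength _ (base _)     = inj₁ refl
    Lex-≤-sameLength e (this c<d)   = inj₂ (here c<d)
    Lex-≤-sameLength e (next refl l) with Lex-≤-sameLength (cong pred e) l
    ... | inj₁ refl = inj₁ refl
    ... | inj₂ l′   = inj₂ (there l′)

    decTotalOrderA : DecTotalOrder 0ℓ 0ℓ 0ℓ
    decTotalOrderA = record { isDecTotalOrder = ≤A.isDecTotalOrder stoA }

    strictTotalOrderD : StrictTotalOrder 0ℓ 0ℓ 0ℓ
    strictTotalOrderD = record { isStrictTotalOrder = stoD }

    module SortA = Sort decTotalOrderA
    module SortD = Sort (Lex.≤-decTotalOrder strictTotalOrderD)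

  clustered-sorted : ∀ {cs} u → AllPairs _<A_ cs → AllPairs _≤A_ (clustered cs u)
  clustered-sorted u [] = []
  clustered-sorted {c ∷ cs} u (c<cs ∷ cs↗) =
    AllPairs.++⁺ (replicate-sorted (count c u)) (clustered-sorted u cs↗) (All.replicate⁺ (count c u) c≤rest)
    where
      replicate-sorted : ∀ n → AllPairs _≤A_ (replicate n c)
      replicate-sorted zero    = []
      replicate-sorted (suc n) = All.replicate⁺ n (inj₂ refl) ∷ replicate-sorted n
      c≤rest : All (c ≤A_) (clustered cs u)
      c≤rest = All.concat⁺ (All.map⁺ (All-map (λ c<d → All.replicate⁺ _ (inj₁ c<d)) c<cs))

  sortedAlphabet : List (Fin r)
  sortedAlphabet = SortA.sort (allFin r)

  sortedAlphabet-unique : Unique.Unique sortedAlphabet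
  sortedAlphabet-unique = PermutationSetoid.Unique-resp-↭ (setoid (Fin r))
    (↭⇒↭ₛ (↭-sym (SortA.sort-↭ (allFin r)))) (Unique.allFin⁺ r)

  sortedAlphabet-complete : ∀ x → x ∈ sortedAlphabet
  sortedAlphabet-complete x = ∈-resp-↭ (↭-sym (SortA.sort-↭ (allFin r))) (∈-allFin x)

  sortedAlphabet-strict : Linked _<A_ sortedAlphabet
  sortedAlphabet-strict = strictify (SortA.sort-↗ (allFin r)) sortedAlphabet-unique
    where
      strictify : ∀ {xs} → Linked _≤A_ xs → Unique.Unique xs → Linked _<A_ xs
      strictify []                  _                = []
      strictify [-]                 _                = [-]
      strictify (inj₁ x<y  ∷ xs↗) (_ ∷ xs!)         = x<y ∷ strictify xs↗ xs!
      strictify (inj₂ refl ∷ _)   ((x≢x ∷ _) ∷ _)   = ⊥-elim (x≢x refl)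

  clusters-[] : Clusters _<A_ _<D_ []
  clusters-[] = sortedAlphabet , SortA.sort-↭ (allFin r) , sortedAlphabet-strict , [] , ↭-refl , [] ,
                cong (map just) (sym (clustered-[] sortedAlphabet))

  NoBWTInversion : Word r → Set
  NoBWTInversion u = ∀ {x y a b} → x ∈ conjugates u → y ∈ conjugates u → LexDiff _<D_ x y →
                     last x ≡ just a → last y ≡ just b → ¬ b <A a

  clusters⇒noBWTInversion : ∀ {u} → Clusters _<A_ _<D_ u → NoBWTInversion u
  clusters⇒noBWTInversion {u} (cs , _ , cs↗ , ks , ks↭ , ks↗ , lasts) x∈ y∈ x<y lx ly b<a
    with allPairs-∈ ks↗↗ (∈-resp-↭ (↭-sym ks↭) x∈) (∈-resp-↭ (↭-sym ks↭) y∈)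
    where
      LastLetters≤ : Rel (Word r) 0ℓ
      LastLetters≤ x y = ∀ {a b} → last x ≡ just a → last y ≡ just b → a ≤A b
      JustLetters≤ : Rel (Maybe (Fin r)) 0ℓ
      JustLetters≤ m n = ∀ {a b} → m ≡ just a → n ≡ just b → a ≤A b
      lasts↗ : AllPairs LastLetters≤ ks
      lasts↗ = AllPairs.map⁻ {R = JustLetters≤} (subst (AllPairs JustLetters≤) (sym lasts) (AllPairs.map⁺
        (AllPairs-map (λ { a≤b refl refl → a≤b }) (clustered-sorted u (Linked⇒AllPairs SA.trans cs↗)))))
      ks↗↗ : AllPairs (λ x y → Lex-≤ _≡_ _<D_ x y × LastLetters≤ x y) ks
      ks↗↗ = AllPairs-zip (Linked⇒AllPairs (Lex.≤-transitive isEquivalence (resp₂ _<D_) SD.trans) ks↗ , lasts↗)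
  ... | inj₁ refl              = LexDiff-irrefl SD.irrefl refl x<y
  ... | inj₂ (inj₁ (_ , a≤b)) = ≤A⇒≯ (a≤b lx ly) b<a
  ... | inj₂ (inj₂ (y≤x , _)) = LexDiff⇒≱ x<y y≤x

  noBWTInversion⇒clusters : ∀ c u′ → NoBWTInversion (c ∷ u′) → Clusters _<A_ _<D_ (c ∷ u′)
  noBWTInversion⇒clusters c u′ noInversion =
    sortedAlphabet , SortA.sort-↭ (allFin r) , sortedAlphabet-strict , ks , SortD.sort-↭ (conjugates u) ,
    SortD.sort-↗ (conjugates u) , trans lasts (cong (map just) bwt≡)
    where
      open Periodic c u′ using (u; N; T; ∈conjugates⇒window; lastOr-conjugates-↭)
      ks = SortD.sort (conjugates u)
      last≡ : ∀ {x} → x ∈ conjugates u → last x ≡ just (lastOr c x)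
      last≡ x∈ with ∈conjugates⇒window x∈
      ... | i , _ , refl = last≡lastOr c (window T i N) (length u′) (length-window T i N)
      ks⊆ : All (_∈ conjugates u) ks
      ks⊆ = All-resp-↭ (↭-sym (SortD.sort-↭ (conjugates u))) (All-tabulate (λ x∈ → x∈))
      lasts : map last ks ≡ map just (map (lastOr c) ks)
      lasts = trans (map-cong-local (All-map last≡ ks⊆)) (map-∘ ks)
      step : ∀ {x y} → x ∈ conjugates u → y ∈ conjugates u → Lex-≤ _≡_ _<D_ x y → lastOr c x ≤A lastOr c y
      step {x} {y} x∈ y∈ x≤y with ∈conjugates⇒window x∈ | ∈conjugates⇒window y∈
      ... | i , _ , refl | j , _ , refl with Lex-≤-sameLength (trans (length-window T i N) (sym (length-window T j N))) x≤y
      ...   | inj₁ x≡y = inj₂ (cong (lastOr c) x≡y)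
      ...   | inj₂ x<y with SA.compare (lastOr c (window T i N)) (lastOr c (window T j N))
      ...     | tri< a<b _ _ = inj₁ a<b
      ...     | tri≈ _ a≡b _ = inj₂ a≡b
      ...     | tri> _ _ b<a = ⊥-elim (noInversion x∈ y∈ x<y (last≡ x∈) (last≡ y∈) b<a)
      bwt≡ : map (lastOr c) ks ≡ clustered sortedAlphabet u
      bwt≡ = Pointwise-≡⇒≡ (Sorted.↗↭↗⇒≋ (DecTotalOrder.totalOrder decTotalOrderA)
        (Linked-map-All (lastOr c) step (SortD.sort-↗ (conjugates u)) ks⊆)
        (AllPairs⇒Linked (clustered-sorted u (Linked⇒AllPairs SA.trans sortedAlphabet-strict)))
        (↭⇒↭ₛ′ isEquivalence (↭-trans (Permutation.map⁺ (lastOr c) (SortD.sort-↭ (conjugates u)))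
          (↭-trans lastOr-conjugates-↭ (clustered-↭ sortedAlphabet sortedAlphabet-unique sortedAlphabet-complete u)))))

  module _ (c : Fin r) (u′ : Word r) where
    open Periodic c u′

    private
      last-window : ∀ i → last (window T i N) ≡ just (T (i + length u′))
      last-window i = trans (last≡lastOr c (window T i N) (length u′) (length-window T i N)) (cong just (lastOr-window c T i (length u′)))

    noBWTInversion⇒inversionFree : NoBWTInversion u → ∀ B → InversionFree T _<A_ _<D_ B
    noBWTInversion⇒inversionFree noInversion B inv = by-cases (k <? N)
      where
        open Inversion inv
        last-letter : ∀ x → last (window T (suc x % N) N) ≡ just (T x)
        last-letter x = trans (last-window (suc x % N)) (cong just (trans (T-% (suc x) (length u′)) (T-+n x)))
        by-cases : Dec (k < N) → ⊥
        by-cases (yes k<N) = noInversion (window∈conjugates (m%n<n (suc p) N)) (window∈conjugates (m%n<n (suc q) N))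
          (LexDiff-window⁺ T (suc p % N) (suc q % N) k<N k<N
            (λ m m<k → trans (T-% (suc p) m) (trans (agree m m<k) (sym (T-% (suc q) m))))
            (subst₂ _<D_ (sym (T-% (suc p) k)) (sym (T-% (suc q) k)) differ))
          (last-letter p) (last-letter q) inverted
        by-cases (no k≮N) = SD.irrefl
          (trans (sym (T-+% (suc p) k)) (trans (agree (k % N) (<-≤-trans (m%n<n k N) (≮⇒≥ k≮N))) (T-+% (suc q) k)))
          differ

    inversionFree⇒noBWTInversion : ∀ B → InversionFree T _<A_ _<D_ B → NoBWTInversion u
    inversionFree⇒noBWTInversion B free x∈ y∈ x<y lx ly b<a
      with ∈conjugates⇒window x∈ | ∈conjugates⇒window y∈
    ... | i , _ , refl | j , _ , refl with LexDiff-window⁻ T i j N x<y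
    ... | k , _ , agree , differ = free record
      { p        = i + n + B * N
      ; q        = j + n + B * N
      ; k        = k
      ; B≤p      = ≤-trans (m≤m*n B N) (m≤n+m (B * N) (i + n))
      ; B≤q      = ≤-trans (m≤m*n B N) (m≤n+m (B * N) (j + n))
      ; agree    = λ m m<k → trans (T-+*N i m B) (trans (agree m m<k) (sym (T-+*N j m B)))
      ; differ   = subst₂ _<D_ (sym (T-+*N i k B)) (sym (T-+*N j k B)) differ
      ; inverted = subst₂ _<A_ (letter j ly) (letter i lx) b<a
      }
      where
        n = length u′
        letter : ∀ i {a} → last (window T i N) ≡ just a → a ≡ T (i + n + B * N)
        letter i {a} la = trans (just-injective (trans (sym la) (last-window i))) (sym (T-periodic (i + n) B))

    clusters⇔inversionFree : ∀ B → Clusters _<A_ _<D_ u ⇔ InversionFree T _<A_ _<D_ B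
    clusters⇔inversionFree B = mk⇔
      (λ cl → noBWTInversion⇒inversionFree (clusters⇒noBWTInversion cl) B)
      (λ free → noBWTInversion⇒clusters c u′ (inversionFree⇒noBWTInversion B free))

-- From position β 0 on, T reads ψ (V 0) ψ (V 1) ⋯, and w ends at every block boundary past |w|.
record BlockCoding {r s : ℕ} (w : Word r) (ψ : Fin s → Word r) (T : ℕ → Fin r) (V : ℕ → Fin s) : Set where
  field
    β        : ℕ → ℕ
    β-suc    : ∀ m → β (suc m) ≡ β m + length (ψ (V m))
    β-zero   : β 0 ≤ length w
    block    : ∀ m → window T (β m) (length (ψ (V m))) ≡ ψ (V m)
    w-ends   : ∀ m → length w ≤ β m → window T (β m ∸ length w) (length w) ≡ w
    maxBlock : ℕ
    block-≤  : ∀ m → length (ψ (V m)) ≤ maxBlock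

module MorphicImage {r s : ℕ} (φ : Fin s → Word r) (b : Fin s) (v′ : Word s) (c : Fin r) (u′ : Word r)
                    (φv≡u : morph φ (b ∷ v′) ≡ c ∷ u′) where

  module V = Periodic b v′
  module U = Periodic c u′

  β : ℕ → ℕ
  β zero    = 0
  β (suc m) = β m + length (φ (V.T m))

  private
    open ≡-Reasoning

    letter : ℕ → Fin s
    letter k = nth V.u k b

    prefixLength : ℕ → ℕ
    prefixLength k = length (morph φ (take k V.u))

    u-split : ∀ k → k < V.N → U.u ≡ morph φ (take k V.u) ++ φ (letter k) ++ morph φ (drop (suc k) V.u)
    u-split k k<N = begin
      U.u                                                     ≡⟨ φv≡u ⟨
      morph φ V.u                                             ≡⟨ cong (morph φ) (take++drop≡id k V.u) ⟨
      morph φ (take k V.u ++ drop k V.u)                       ≡⟨ concatMap-++ φ (take k V.u) (drop k V.u) ⟩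
      morph φ (take k V.u) ++ morph φ (drop k V.u)             ≡⟨ cong (λ z → morph φ (take k V.u) ++ morph φ z) (drop-nth V.u k b k<N) ⟩
      morph φ (take k V.u) ++ φ (letter k) ++ morph φ (drop (suc k) V.u) ∎

    prefixLength-suc : ∀ k → k < V.N → prefixLength (suc k) ≡ prefixLength k + length (φ (letter k))
    prefixLength-suc k k<N = begin
      length (morph φ (take (suc k) V.u))                     ≡⟨ cong (λ z → length (morph φ z)) (take-suc-nth V.u k b k<N) ⟩
      length (morph φ (take k V.u ++ [ letter k ]))            ≡⟨ cong length (concatMap-++ φ (take k V.u) [ letter k ]) ⟩
      length (morph φ (take k V.u) ++ φ (letter k) ++ [])      ≡⟨ length-++ (morph φ (take k V.u)) ⟩
      prefixLength k + length (φ (letter k) ++ [])             ≡⟨ cong (λ z → prefixLength k + length z) (++-identityʳ (φ (letter k))) ⟩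
      prefixLength k + length (φ (letter k))                   ∎

    prefixLength-N : prefixLength V.N ≡ U.N
    prefixLength-N = trans (cong (λ z → length (morph φ z)) (take-all V.N V.u ≤-refl)) (cong length φv≡u)

    block-bound : ∀ k → k < V.N → prefixLength k + length (φ (letter k)) ≤ U.N
    block-bound k k<N = ≤-trans (+-monoʳ-≤ (prefixLength k) (m≤m+n _ (length rest))) (≤-reflexive (sym lengths))
      where
        rest = morph φ (drop (suc k) V.u)
        lengths : U.N ≡ prefixLength k + (length (φ (letter k)) + length rest)
        lengths = trans (cong length (u-split k k<N))
          (trans (length-++ (morph φ (take k V.u))) (cong (prefixLength k +_) (length-++ (φ (letter k)))))

    V-T : ∀ m q k → m ≡ k + q * V.N → k < V.N → V.T m ≡ letter k
    V-T m q k refl k<N = cong (λ z → nth V.u z b) (trans ([m+kn]%n≡m%n k q V.N) (m<n⇒m%n≡m k<N))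

    Position : ℕ → Set
    Position m = ∃[ q ] ∃[ k ] (k < V.N × m ≡ k + q * V.N × β m ≡ prefixLength k + q * U.N)

    position : ∀ m → Position m
    position zero = 0 , 0 , s≤s z≤n , refl , refl
    position (suc m) with position m
    ... | q , k , k<N , m≡ , βm≡ with suc k <? V.N
    ...   | yes k+1<N = q , suc k , k+1<N , cong suc m≡ , (begin
            β m + length (φ (V.T m))                   ≡⟨ cong₂ _+_ βm≡ (cong (λ z → length (φ z)) (V-T m q k m≡ k<N)) ⟩
            prefixLength k + q * U.N + length (φ (letter k)) ≡⟨ xy∙z≈xz∙y (prefixLength k) (q * U.N) _ ⟩
            prefixLength k + length (φ (letter k)) + q * U.N ≡⟨ cong (_+ q * U.N) (prefixLength-suc k k<N) ⟨
            prefixLength (suc k) + q * U.N               ∎)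
    ...   | no k+1≮N = suc q , 0 , s≤s z≤n , trans (cong suc m≡) (cong (_+ q * V.N) k+1≡N) , (begin
            β m + length (φ (V.T m))                   ≡⟨ cong₂ _+_ βm≡ (cong (λ z → length (φ z)) (V-T m q k m≡ k<N)) ⟩
            prefixLength k + q * U.N + length (φ (letter k)) ≡⟨ xy∙z≈xz∙y (prefixLength k) (q * U.N) _ ⟩
            prefixLength k + length (φ (letter k)) + q * U.N ≡⟨ cong (_+ q * U.N) (prefixLength-suc k k<N) ⟨
            prefixLength (suc k) + q * U.N               ≡⟨ cong (λ z → prefixLength z + q * U.N) k+1≡N ⟩
            prefixLength V.N + q * U.N                   ≡⟨ cong (_+ q * U.N) prefixLength-N ⟩
            suc q * U.N                                  ∎)
      where
        k+1≡N : suc k ≡ V.N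
        k+1≡N = ≤-antisym k<N (≮⇒≥ k+1≮N)

  block : ∀ m → window U.T (β m) (length (φ (V.T m))) ≡ φ (V.T m)
  block m with position m
  ... | q , k , k<N , m≡ , βm≡ rewrite V-T m q k m≡ k<N = begin
    window U.T (β m) ℓ                          ≡⟨ cong (λ z → window U.T z ℓ) βm≡ ⟩
    window U.T (prefixLength k + q * U.N) ℓ     ≡⟨ window-cong U.T U.T _ _ ℓ (λ i _ →
                                                    trans (cong U.T (xy∙z≈xz∙y (prefixLength k) (q * U.N) i)) (U.T-periodic (prefixLength k + i) q)) ⟩
    window U.T (prefixLength k) ℓ               ≡⟨ U.window-T (prefixLength k) ℓ (block-bound k k<N) ⟩
    take ℓ (drop (prefixLength k) U.u)          ≡⟨ cong (λ z → take ℓ (drop (prefixLength k) z)) (u-split k k<N) ⟩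
    take ℓ (drop (prefixLength k) (morph φ (take k V.u) ++ φ (letter k) ++ _))
                                                ≡⟨ cong (take ℓ) (drop-length-++ (morph φ (take k V.u)) _) ⟩
    take ℓ (φ (letter k) ++ morph φ (drop (suc k) V.u)) ≡⟨ take-length-++ (φ (letter k)) _ ⟩
    φ (letter k)                                ∎
    where ℓ = length (φ (letter k))

  block-≤ : ∀ m → length (φ (V.T m)) ≤ U.N
  block-≤ m with position m
  ... | q , k , k<N , m≡ , _ rewrite V-T m q k m≡ k<N = ≤-trans (m≤n+m _ (prefixLength k)) (block-bound k k<N)

  window-β : ∀ m l → window U.T (β m) (length (φ (V.T m)) + l) ≡ φ (V.T m) ++ window U.T (β (suc m)) l
  window-β m l = trans (window-+ U.T (β m) _ l) (cong (_++ window U.T (β (suc m)) l) (block m))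

  module _ (w : Word r) (ends : ∀ i → IsSuffix w (w ++ φ i)) where

    w++prefix : ∀ m → ∃[ P ] (w ++ window U.T 0 (β m) ≡ P ++ w)
    w++prefix zero = [] , ++-identityʳ w
    w++prefix (suc m) with w++prefix m | ends (V.T m)
    ... | P , eP | Q , eQ = P ++ Q , (begin
      w ++ window U.T 0 (β m + length (φ (V.T m)))           ≡⟨ cong (w ++_) (window-+ U.T 0 (β m) _) ⟩
      w ++ window U.T 0 (β m) ++ window U.T (β m) (length (φ (V.T m)))
                                                             ≡⟨ cong (λ z → w ++ window U.T 0 (β m) ++ z) (block m) ⟩
      w ++ window U.T 0 (β m) ++ φ (V.T m)                   ≡⟨ ++-assoc w _ _ ⟨
      (w ++ window U.T 0 (β m)) ++ φ (V.T m)                 ≡⟨ cong (_++ φ (V.T m)) eP ⟩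
      (P ++ w) ++ φ (V.T m)                                  ≡⟨ ++-assoc P w _ ⟩
      P ++ w ++ φ (V.T m)                                    ≡⟨ cong (P ++_) eQ ⟨
      P ++ Q ++ w                                            ≡⟨ ++-assoc P Q w ⟨
      (P ++ Q) ++ w                                          ∎)
      where open ≡-Reasoning

    w-ends : ∀ m → length w ≤ β m → window U.T (β m ∸ length w) (length w) ≡ w
    w-ends m w≤β with w++prefix m
    ... | P , eP = proj₂ (++-injectiveʳ (w ++ window U.T 0 (β m ∸ length w)) _ P w (length-window U.T _ _) (begin
      (w ++ window U.T 0 (β m ∸ length w)) ++ window U.T (β m ∸ length w) (length w)
                                                   ≡⟨ ++-assoc w _ _ ⟩
      w ++ window U.T 0 (β m ∸ length w) ++ window U.T (β m ∸ length w) (length w)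
                                                   ≡⟨ cong (w ++_) (window-+ U.T 0 (β m ∸ length w) (length w)) ⟨
      w ++ window U.T 0 (β m ∸ length w + length w) ≡⟨ cong (λ z → w ++ window U.T 0 z) (m∸n+n≡m w≤β) ⟩
      w ++ window U.T 0 (β m)                      ≡⟨ eP ⟩
      P ++ w                                       ∎))
      where open ≡-Reasoning

    suffixCoding : BlockCoding w φ U.T V.T
    suffixCoding = record
      { β = β ; β-suc = λ _ → refl ; β-zero = z≤n ; block = block ; w-ends = w-ends
      ; maxBlock = U.N ; block-≤ = block-≤ }

  module _ (w : Word r) (nonempty : ∀ i → 0 < length (φ i)) (starts : ∀ i → IsPrefix w (φ i ++ w)) where

    private
      blocksLength : ℕ → ℕ → ℕ
      blocksLength zero    m = 0
      blocksLength (suc K) m = length (φ (V.T m)) + blocksLength K (suc m)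

      blocksLength-≥ : ∀ K m → K ≤ blocksLength K m
      blocksLength-≥ zero    m = z≤n
      blocksLength-≥ (suc K) m = +-mono-≤ (nonempty (V.T m)) (blocksLength-≥ K (suc m))

      blocks++w : ∀ K m → ∃[ Y ] (window U.T (β m) (blocksLength K m) ++ w ≡ w ++ Y)
      blocks++w zero    m = [] , sym (++-identityʳ w)
      blocks++w (suc K) m with blocks++w K (suc m) | starts (V.T m)
      ... | Y , eY | Z , eZ = Z ++ Y , (begin
        window U.T (β m) (length (φ (V.T m)) + blocksLength K (suc m)) ++ w
                                                        ≡⟨ cong (_++ w) (window-β m _) ⟩
        (φ (V.T m) ++ window U.T (β (suc m)) (blocksLength K (suc m))) ++ w
                                                        ≡⟨ ++-assoc (φ (V.T m)) _ w ⟩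
        φ (V.T m) ++ window U.T (β (suc m)) (blocksLength K (suc m)) ++ w
                                                        ≡⟨ cong (φ (V.T m) ++_) eY ⟩
        φ (V.T m) ++ w ++ Y                             ≡⟨ ++-assoc (φ (V.T m)) w Y ⟨
        (φ (V.T m) ++ w) ++ Y                           ≡⟨ cong (_++ Y) eZ ⟨
        (w ++ Z) ++ Y                                   ≡⟨ ++-assoc w Z Y ⟩
        w ++ Z ++ Y                                     ∎)
        where open ≡-Reasoning

      take-++-≤ : ∀ {A : Set} k (X Y : List A) → k ≤ length X → take k (X ++ Y) ≡ take k X
      take-++-≤ zero    X       Y _       = refl
      take-++-≤ (suc k) (x ∷ X) Y (s≤s h) = cong (x ∷_) (take-++-≤ k X Y h)

    w-starts : ∀ m → window U.T (β m) (length w) ≡ w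
    w-starts m with blocks++w (length w) m
    ... | Y , eY = begin
      window U.T (β m) (length w)                                  ≡⟨ take-window U.T (β m) |w|≤ ⟨
      take (length w) (window U.T (β m) ℓ)                         ≡⟨ take-++-≤ (length w) _ w (subst (length w ≤_) (sym (length-window U.T _ _)) |w|≤) ⟨
      take (length w) (window U.T (β m) ℓ ++ w)                    ≡⟨ cong (take (length w)) eY ⟩
      take (length w) (w ++ Y)                                     ≡⟨ take-length-++ w Y ⟩
      w                                                            ∎
      where
        open ≡-Reasoning
        ℓ = blocksLength (length w) m
        |w|≤ : length w ≤ ℓ
        |w|≤ = blocksLength-≥ (length w) m

    private
      ψ : Fin s → Word r
      ψ i = proj₁ (starts i)

      |ψ|≡|φ| : ∀ i → length (ψ i) ≡ length (φ i)
      |ψ|≡|φ| i = +-cancelˡ-≡ (length w) _ _ (trans (sym (length-++ w))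
        (trans (cong length (proj₂ (starts i))) (trans (length-++ (φ i)) (+-comm (length (φ i)) (length w)))))

      block′ : ∀ m → window U.T (β m + length w) (length (ψ (V.T m))) ≡ ψ (V.T m)
      block′ m = ++-cancelˡ w _ _ (begin
        w ++ window U.T (β m + length w) (length (ψ (V.T m)))   ≡⟨ cong (_++ window U.T (β m + length w) (length (ψ (V.T m)))) (w-starts m) ⟨
        window U.T (β m) (length w) ++ window U.T (β m + length w) (length (ψ (V.T m)))
                                                               ≡⟨ window-+ U.T (β m) (length w) _ ⟨
        window U.T (β m) (length w + length (ψ (V.T m)))      ≡⟨ cong (window U.T (β m))
                                                                   (trans (cong (length w +_) (|ψ|≡|φ| (V.T m))) (+-comm (length w) _)) ⟩
        window U.T (β m) (length (φ (V.T m)) + length w)      ≡⟨ window-β m (length w) ⟩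
        φ (V.T m) ++ window U.T (β (suc m)) (length w)        ≡⟨ cong (φ (V.T m) ++_) (w-starts (suc m)) ⟩
        φ (V.T m) ++ w                                        ≡⟨ proj₂ (starts (V.T m)) ⟨
        w ++ ψ (V.T m)                                        ∎)
        where open ≡-Reasoning

    prefixCoding : BlockCoding w ψ U.T V.T
    prefixCoding = record
      { β        = λ m → β m + length w
      ; β-suc    = λ m → trans (+-assoc (β m) _ (length w)) (trans (cong (β m +_)
                     (trans (+-comm (length (φ (V.T m))) (length w)) (cong (length w +_) (sym (|ψ|≡|φ| (V.T m))))))
                     (sym (+-assoc (β m) (length w) _)))
      ; β-zero   = ≤-refl
      ; block    = block′
      ; w-ends   = λ m _ → trans (cong (λ z → window U.T z (length w)) (m+n∸n≡m (β m) (length w))) (w-starts m)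
      ; maxBlock = U.N
      ; block-≤  = λ m → subst (_≤ U.N) (sym (|ψ|≡|φ| (V.T m))) (block-≤ m)
      }

module StrictlyIncreasing (f : ℕ → ℕ) (f-suc : ∀ m → f m < f (suc m)) where

  mono-< : ∀ {a b} → a < b → f a < f b
  mono-< {a} {suc b} (s≤s a≤b) with m≤n⇒m<n∨m≡n a≤b
  ... | inj₁ a<b  = <-trans (mono-< a<b) (f-suc b)
  ... | inj₂ refl = f-suc a

  mono-≤ : ∀ {a b} → a ≤ b → f a ≤ f b
  mono-≤ a≤b with m≤n⇒m<n∨m≡n a≤b
  ... | inj₁ a<b  = <⇒≤ (mono-< a<b)
  ... | inj₂ refl = ≤-refl

  cancel-< : ∀ {a b} → f a < f b → a < b
  cancel-< {a} {b} fa<fb with a <? b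
  ... | yes a<b = a<b
  ... | no a≮b  = ⊥-elim (<⇒≱ fa<fb (mono-≤ (≮⇒≥ a≮b)))

  no-value-between : ∀ {m c} → f m < f c → f c < f (suc m) → ⊥
  no-value-between fm<fc fc<fm+1 = <⇒≱ (cancel-< fc<fm+1) (cancel-< fm<fc)

  id≤ : ∀ m → m ≤ f m
  id≤ zero    = z≤n
  id≤ (suc m) = ≤-trans (s≤s (id≤ m)) (f-suc m)

  locate : ∀ x → f 0 ≤ x → ∃[ m ] (f m ≤ x × x < f (suc m))
  locate zero    f0≤x = 0 , f0≤x , ≤-<-trans z≤n (f-suc 0)
  locate (suc x) f0≤x with f 0 ≤? x
  ... | no f0≰x  = 0 , f0≤x , ≤-<-trans (≰⇒> f0≰x) (f-suc 0)
  ... | yes f0≤x′ with locate x f0≤x′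
  ...   | m , fm≤x , x<fm+1 with m≤n⇒m<n∨m≡n x<fm+1
  ...     | inj₁ x+1<fm+1 = m , ≤-trans fm≤x (n≤1+n x) , x+1<fm+1
  ...     | inj₂ x+1≡fm+1 = suc m , ≤-reflexive (sym x+1≡fm+1) , subst (_< f (suc (suc m))) (sym x+1≡fm+1) (f-suc (suc m))

module Transfer {r s : ℕ} {L : Language r} (isL : IsLanguage L)
                {w : Word r} {ψ : Fin s → Word r} (family : SuffixReturnFamily L w ψ)
                {T : ℕ → Fin r} {V : ℕ → Fin s} (coding : BlockCoding w ψ T V) where

  open SuffixReturnFamily family
  open BlockCoding coding

  |w| : ℕ
  |w| = length w

  β-<-suc : ∀ m → β m < β (suc m)
  β-<-suc m = subst (β m <_) (sym (β-suc m)) (m<m+n (β m) (nonempty (V m)))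

  open StrictlyIncreasing β β-<-suc

  IsBoundary : ℕ → Set
  IsBoundary x = ∃[ m ] (β m ≡ x)

  factor∈L : ∀ x y z → L (x ++ y ++ z) → L y
  factor∈L = proj₁ (proj₂ isL)

  |w|≤β : ∀ {m x} → x < β (suc m) → maxBlock + |w| ≤ x → |w| ≤ β m
  |w|≤β {m} {x} x<β bound≤x = +-cancelˡ-≤ maxBlock |w| (β m) (begin
    maxBlock + |w|                ≤⟨ bound≤x ⟩
    x                             ≤⟨ <⇒≤ x<β ⟩
    β (suc m)                     ≡⟨ β-suc m ⟩
    β m + length (ψ (V m))        ≤⟨ +-monoʳ-≤ (β m) (block-≤ m) ⟩
    β m + maxBlock                ≡⟨ +-comm (β m) maxBlock ⟩
    maxBlock + β m                ∎)
    where open ≤-Reasoning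

  module _ {m} (|w|≤βm : |w| ≤ β m) where

    w++block : window T (β m ∸ |w|) (|w| + length (ψ (V m))) ≡ w ++ ψ (V m)
    w++block = trans (window-+ T (β m ∸ |w|) |w| _) (cong₂ _++_ (w-ends m |w|≤βm)
      (trans (cong (λ z → window T z (length (ψ (V m)))) (m∸n+n≡m |w|≤βm)) (block m)))

    w++block-end : (β m ∸ |w|) + (|w| + length (ψ (V m))) ≡ β (suc m)
    w++block-end = trans (sym (+-assoc (β m ∸ |w|) |w| _))
      (trans (cong (_+ length (ψ (V m))) (m∸n+n≡m |w|≤βm)) (sym (β-suc m)))

    window∈L : ∀ a l → β m ∸ |w| ≤ a → a + l ≤ β (suc m) → L (window T a l)
    window∈L a l start≤a end≤ with window-infix T (β m ∸ |w|) (|w| + length (ψ (V m))) a l start≤a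
                                     (subst (a + l ≤_) (sym w++block-end) end≤)
    ... | X , Y , e = factor∈L X (window T a l) Y (subst L (trans (sym w++block) e) (inL (V m)))

  occurrence⇒boundary : ∀ g → maxBlock ≤ g → window T g |w| ≡ w → IsBoundary (g + |w|)
  occurrence⇒boundary g bound≤g occurs with locate (g + |w|) (≤-trans β-zero (m≤n+m |w| g))
  ... | m , βm≤ , <βm+1 with m≤n⇒m<n∨m≡n βm≤
  ...   | inj₂ βm≡ = m , βm≡
  ...   | inj₁ βm< = ⊥-elim (noInteriorOccurrence w (ψ (V m)) (twoOccurrences (V m)) (endsWith (V m))
                               (m<n⇒0<n∸m βm<) o<ψ interior)
    where
      |w|≤βm : |w| ≤ β m
      |w|≤βm = |w|≤β <βm+1 (+-monoˡ-≤ |w| bound≤g)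
      o = g + |w| ∸ β m
      start+o≡g : (β m ∸ |w|) + o ≡ g
      start+o≡g = +-cancelʳ-≡ |w| _ g (begin
        (β m ∸ |w|) + o + |w|       ≡⟨ +-assoc (β m ∸ |w|) o |w| ⟩
        (β m ∸ |w|) + (o + |w|)     ≡⟨ cong ((β m ∸ |w|) +_) (+-comm o |w|) ⟩
        (β m ∸ |w|) + (|w| + o)     ≡⟨ +-assoc (β m ∸ |w|) |w| o ⟨
        (β m ∸ |w|) + |w| + o       ≡⟨ cong (_+ o) (m∸n+n≡m |w|≤βm) ⟩
        β m + o                     ≡⟨ m+[n∸m]≡n (<⇒≤ βm<) ⟩
        g + |w|                     ∎)
        where open ≡-Reasoning
      o<ψ : o < length (ψ (V m))
      o<ψ = +-cancelˡ-< (β m) o _ (subst₂ _<_ (sym (m+[n∸m]≡n (<⇒≤ βm<))) (β-suc m) <βm+1)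
      interior : OccursAt w (w ++ ψ (V m)) o
      interior = begin
        take |w| (drop o (w ++ ψ (V m)))                                  ≡⟨ cong (λ z → take |w| (drop o z)) (w++block |w|≤βm) ⟨
        take |w| (drop o (window T (β m ∸ |w|) (|w| + length (ψ (V m))))) ≡⟨ cong (take |w|) (drop-window T _ o _) ⟩
        take |w| (window T ((β m ∸ |w|) + o) (|w| + length (ψ (V m)) ∸ o)) ≡⟨ take-window T _ (subst (|w| ≤_)
                                                                               (sym (+-∸-assoc |w| (<⇒≤ o<ψ))) (m≤m+n |w| _)) ⟩
        window T ((β m ∸ |w|) + o) |w|                                    ≡⟨ cong (λ z → window T z |w|) start+o≡g ⟩
        window T g |w|                                                    ≡⟨ occurs ⟩
        w                                                                 ∎
        where open ≡-Reasoning

  boundary-sync : ∀ p q k → maxBlock ≤ q → (∀ m → m < k → T (suc p + m) ≡ T (suc q + m)) →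
                  ∀ o → |w| ≤ o → o ≤ k → IsBoundary (suc p + o) → IsBoundary (suc q + o)
  boundary-sync p q k bound≤q agree o |w|≤o o≤k (a , βa≡)
    with occurrence⇒boundary (suc q + (o ∸ |w|)) (≤-trans bound≤q (≤-trans (n≤1+n q) (m≤m+n (suc q) _))) occurs
    where
      |w|≤βa : |w| ≤ β a
      |w|≤βa = subst (|w| ≤_) (sym βa≡) (≤-trans |w|≤o (m≤n+m o (suc p)))
      occurs : window T (suc q + (o ∸ |w|)) |w| ≡ w
      occurs = begin
        window T (suc q + (o ∸ |w|)) |w|  ≡⟨ window-cong T T _ _ |w| (λ i i<|w| → begin
                                               T (suc p + (o ∸ |w|) + i)   ≡⟨ cong T (+-assoc (suc p) (o ∸ |w|) i) ⟩
                                               T (suc p + ((o ∸ |w|) + i)) ≡⟨ agree _ (<-≤-trans (subst ((o ∸ |w|) + i <_) (m∸n+n≡m |w|≤o)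
                                                                                (+-monoʳ-< (o ∸ |w|) i<|w|)) o≤k) ⟩
                                               T (suc q + ((o ∸ |w|) + i)) ≡⟨ cong T (+-assoc (suc q) (o ∸ |w|) i) ⟨
                                               T (suc q + (o ∸ |w|) + i)   ∎) ⟨
        window T (suc p + (o ∸ |w|)) |w|  ≡⟨ cong (λ z → window T z |w|) (trans (sym (+-∸-assoc (suc p) |w|≤o)) (cong (_∸ |w|) (sym βa≡))) ⟩
        window T (β a ∸ |w|) |w|          ≡⟨ w-ends a |w|≤βa ⟩
        w                                 ∎
        where open ≡-Reasoning
  ... | b , βb≡ = b , trans βb≡ (trans (+-assoc (suc q) (o ∸ |w|) |w|) (cong (suc q +_) (m∸n+n≡m |w|≤o)))

  blocks : ℕ → ℕ → Word r
  blocks a K = morph ψ (window V a K)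

  window-blocks : ∀ a K → window T (β a) (length (blocks a K)) ≡ blocks a K
  window-blocks a zero    = refl
  window-blocks a (suc K) = begin
    window T (β a) (length (ψ (V a) ++ blocks (suc a) K))                    ≡⟨ cong (window T (β a)) (length-++ (ψ (V a))) ⟩
    window T (β a) (length (ψ (V a)) + length (blocks (suc a) K))            ≡⟨ window-+ T (β a) (length (ψ (V a))) (length (blocks (suc a) K)) ⟩
    window T (β a) (length (ψ (V a))) ++ window T (β a + length (ψ (V a))) _ ≡⟨ cong₂ _++_ (block a)
                                                                                  (cong (λ z → window T z _) (sym (β-suc a))) ⟩
    ψ (V a) ++ window T (β (suc a)) (length (blocks (suc a) K))              ≡⟨ cong (ψ (V a) ++_) (window-blocks (suc a) K) ⟩
    ψ (V a) ++ blocks (suc a) K                                              ∎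
    where open ≡-Reasoning

  β-blocks : ∀ a K → β a + length (blocks a K) ≡ β (a + K)
  β-blocks a zero    = trans (+-identityʳ (β a)) (cong β (sym (+-identityʳ a)))
  β-blocks a (suc K) = begin
    β a + length (ψ (V a) ++ blocks (suc a) K)               ≡⟨ cong (β a +_) (length-++ (ψ (V a))) ⟩
    β a + (length (ψ (V a)) + length (blocks (suc a) K))     ≡⟨ +-assoc (β a) _ _ ⟨
    β a + length (ψ (V a)) + length (blocks (suc a) K)       ≡⟨ cong (_+ length (blocks (suc a) K)) (β-suc a) ⟨
    β (suc a) + length (blocks (suc a) K)                    ≡⟨ β-blocks (suc a) K ⟩
    β (suc a + K)                                            ≡⟨ cong β (+-suc a K) ⟨
    β (a + suc K)                                            ∎
    where open ≡-Reasoning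

  context : ∀ P K → |w| ≤ β P → ∀ Y {d} t R {y} z → w ++ ψ (V P) ≡ Y ++ d ∷ t → ψ (V (suc P + K)) ≡ R ++ y ∷ z →
            let p = β P ∸ |w| + length Y ; M = t ++ blocks (suc P) K ++ R in
            T p ≡ d × window T (suc p) (length M) ≡ M × T (suc p + length M) ≡ y
  context P K |w|≤βP Y {d} t R {y} z eP eK = window-∷-++-∷ T a₀ (ℓ₁ + (ℓ₂ + ℓ₃)) Y (t ++ B ++ R) z (begin
    window T a₀ (ℓ₁ + (ℓ₂ + ℓ₃))                                  ≡⟨ window-+ T a₀ ℓ₁ (ℓ₂ + ℓ₃) ⟩
    window T a₀ ℓ₁ ++ window T (a₀ + ℓ₁) (ℓ₂ + ℓ₃)                ≡⟨ cong₂ _++_ (w++block |w|≤βP)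
                                                                       (cong (λ x → window T x (ℓ₂ + ℓ₃)) (w++block-end |w|≤βP)) ⟩
    (w ++ ψ (V P)) ++ window T (β (suc P)) (ℓ₂ + ℓ₃)              ≡⟨ cong ((w ++ ψ (V P)) ++_) (window-+ T (β (suc P)) ℓ₂ ℓ₃) ⟩
    (w ++ ψ (V P)) ++ window T (β (suc P)) ℓ₂ ++ window T (β (suc P) + ℓ₂) ℓ₃
                                                                  ≡⟨ cong₂ (λ u v → (w ++ ψ (V P)) ++ u ++ v) (window-blocks (suc P) K)
                                                                       (trans (cong (λ x → window T x ℓ₃) (β-blocks (suc P) K)) (block (suc P + K))) ⟩
    (w ++ ψ (V P)) ++ B ++ ψ (V (suc P + K))                      ≡⟨ cong₂ (λ u v → u ++ B ++ v) eP eK ⟩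
    (Y ++ d ∷ t) ++ B ++ R ++ y ∷ z                               ≡⟨ ++-assoc Y (d ∷ t) _ ⟩
    Y ++ d ∷ t ++ B ++ R ++ y ∷ z                                 ≡⟨ cong (λ x → Y ++ d ∷ x) (trans (cong (t ++_) (sym (++-assoc B R _)))
                                                                                                 (sym (++-assoc t (B ++ R) _))) ⟩
    Y ++ d ∷ (t ++ B ++ R) ++ y ∷ z                               ∎)
    where
      open ≡-Reasoning
      a₀ = β P ∸ |w|
      B  = blocks (suc P) K
      ℓ₁ = |w| + length (ψ (V P))
      ℓ₂ = length B
      ℓ₃ = length (ψ (V (suc P + K)))

  letters∈L : ∀ x k m → |w| ≤ β m → β m ≤ x + |w| → suc x + k < β (suc m) →
              L (T x ∷ window T (suc x) k ++ [ T (suc x + k) ])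
  letters∈L x k m |w|≤βm βm≤ <βm+1 = subst L (cong (T x ∷_) (window-+ T (suc x) k 1))
    (window∈L |w|≤βm x (suc (k + 1)) (≤-trans (∸-monoˡ-≤ |w| βm≤) (≤-reflexive (m+n∸n≡m x |w|)))
      (subst (_≤ β (suc m)) (sym (trans (+-suc x (k + 1)) (cong suc (trans (sym (+-assoc x k 1)) (+-comm (x + k) 1))))) <βm+1))

  w++block-split : ∀ m y → |w| ≤ β m → β m ∸ |w| ≤ y → y < β (suc m) →
                   w ++ ψ (V m) ≡ window T (β m ∸ |w|) (y ∸ (β m ∸ |w|)) ++ T y ∷ window T (suc y) (β (suc m) ∸ suc y)
  w++block-split m y |w|≤βm start≤y y<βm+1 = trans (sym (w++block |w|≤βm)) (trans
    (window-split T (β m ∸ |w|) (|w| + length (ψ (V m))) y start≤y (subst (y <_) (sym (w++block-end |w|≤βm)) y<βm+1))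
    (cong (λ e → window T (β m ∸ |w|) (y ∸ (β m ∸ |w|)) ++ T y ∷ window T (suc y) (e ∸ suc y)) (w++block-end |w|≤βm)))

  bispecial : ∀ {x x′ y y′ z} → x ≢ x′ → y ≢ y′ → L (x ∷ z ++ [ y ]) → L (x′ ∷ z ++ [ y′ ]) → Bispecial L z
  bispecial {x} {x′} {y} {y′} {z} x≢x′ y≢y′ xzy∈L x′zy′∈L =
    factor∈L [ x ] z [ y ] xzy∈L ,
    (x , x′ , x≢x′ , factor∈L [] (x ∷ z) [ y ] xzy∈L , factor∈L [] (x′ ∷ z) [ y′ ] x′zy′∈L) ,
    (y , y′ , y≢y′ , factor∈L [ x ] (z ++ [ y ]) [] (subst L (cong (x ∷_) (sym (++-identityʳ _))) xzy∈L)
                   , factor∈L [ x′ ] (z ++ [ y′ ]) [] (subst L (cong (x′ ∷_) (sym (++-identityʳ _))) x′zy′∈L))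

  module _ {_<A_ _<D_ : Rel (Fin r) 0ℓ} {_<Aw_ _<Dw_ : Rel (Fin s) 0ℓ}
           (Aw⇔ : ∀ {i j} → i <Aw j ⇔ AntiLex< _<A_ (w ++ ψ i) (w ++ ψ j))
           (Dw⇔ : ∀ {i j} → i <Dw j ⇔ Lex< _<D_ (ψ i) (ψ j)) where

    inversionFree-descends : InversionFree T _<A_ _<D_ 0 → InversionFree V _<Aw_ _<Dw_ |w|
    inversionFree-descends free inv = free (inversionInT (Equivalence.to Aw⇔ inverted) (Equivalence.to Dw⇔ differ))
      where
        open Inversion inv renaming (p to P; q to Q; k to K)
        inversionInT : AntiLex< _<A_ (w ++ ψ (V Q)) (w ++ ψ (V P)) → Lex< _<D_ (ψ (V (suc P + K))) (ψ (V (suc Q + K))) →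
               Inversion T _<A_ _<D_ 0
        inversionInT (X , Y , c , d , t , eQ , eP , c<d) (R , y , y′ , z , z′ , eK , eK′ , y<y′) = record
          { p = p ; q = q ; k = length M ; B≤p = z≤n ; B≤q = z≤n
          ; agree    = window-injective T T (suc p) (suc q) (length M) (trans windowP (sym windowQ))
          ; differ   = subst₂ _<D_ (sym (proj₂ (proj₂ contextP))) (sym (proj₂ windowQ&y′)) y<y′
          ; inverted = subst₂ _<A_ (sym (proj₁ contextQ)) (sym (proj₁ contextP)) c<d
          }
          where
            p = β P ∸ |w| + length Y
            q = β Q ∸ |w| + length X
            M = t ++ blocks (suc P) K ++ R
            blocks≡ : blocks (suc Q) K ≡ blocks (suc P) K
            blocks≡ = cong (morph ψ) (window-cong V V (suc Q) (suc P) K (λ m m<K → sym (agree m m<K)))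
            contextP = context P K (≤-trans B≤p (id≤ P)) Y t R z eP eK
            contextQ = context Q K (≤-trans B≤q (id≤ Q)) X t R z′ eQ eK′
            windowQ&y′ : window T (suc q) (length M) ≡ M × T (suc q + length M) ≡ y′
            windowQ&y′ = subst (λ B → window T (suc q) (length (t ++ B ++ R)) ≡ t ++ B ++ R × T (suc q + length (t ++ B ++ R)) ≡ y′)
                               blocks≡ (proj₂ contextQ)
            windowP : window T (suc p) (length M) ≡ M
            windowP = proj₁ (proj₂ contextP)
            windowQ : window T (suc q) (length M) ≡ M
            windowQ = proj₁ windowQ&y′

    module InversionInT (asymA : Asymmetric _<A_) (irreflD : Irreflexive _≡_ _<D_) (oc : OrderCondition L _<A_ _<D_)
                (free : InversionFree V _<Aw_ _<Dw_ 0) (inv : Inversion T _<A_ _<D_ (maxBlock + |w|)) where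

      open Inversion inv

      private
        offset : ∀ x {y} → x ≤ y → y ≡ x + (y ∸ x)
        offset x x≤y = sym (m+[n∸m]≡n x≤y)

        bound≤p : maxBlock ≤ p
        bound≤p = ≤-trans (m≤m+n maxBlock |w|) B≤p

        bound≤q : maxBlock ≤ q
        bound≤q = ≤-trans (m≤m+n maxBlock |w|) B≤q

        block-of : ∀ x → |w| ≤ x → ∃[ m ] (β m ≤ x × x < β (suc m))
        block-of x |w|≤x = locate x (≤-trans β-zero |w|≤x)

        |w|≤p+ : ∀ x → |w| ≤ p + x
        |w|≤p+ x = ≤-trans (≤-trans (m≤n+m |w| maxBlock) B≤p) (m≤m+n p x)

        |w|≤q+ : ∀ x → |w| ≤ q + x
        |w|≤q+ x = ≤-trans (≤-trans (m≤n+m |w| maxBlock) B≤q) (m≤m+n q x)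

      p-to-q : ∀ o → |w| ≤ o → o ≤ k → IsBoundary (suc p + o) → IsBoundary (suc q + o)
      p-to-q = boundary-sync p q k bound≤q agree

      no-q-boundary : ∀ a o → |w| ≤ o → o ≤ k → β a < suc p + o → suc p + o < β (suc a) → ¬ IsBoundary (suc q + o)
      no-q-boundary a o |w|≤o o≤k after before qb
        with boundary-sync q p k bound≤p (λ m m<k → sym (agree m m<k)) o |w|≤o o≤k qb
      ... | c , βc≡ = no-value-between (subst (β a <_) (sym βc≡) after) (subst (_< β (suc a)) (sym βc≡) before)

      q-block-starts-early : ∀ a b → β a ≤ p + |w| → β b ≤ suc q + k →
                             (∀ o → β b ≡ suc q + o → suc p + o < β (suc a)) → β b ≤ q + |w|
      q-block-starts-early a b βa≤ βb≤ before with β b ≤? q + |w|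
      ... | yes βb≤q+|w| = βb≤q+|w|
      ... | no  βb≰q+|w| = ⊥-elim (no-q-boundary a o |w|≤o o≤k after (before o βb≡) (b , βb≡))
        where
          o = β b ∸ suc q
          βb≡ : β b ≡ suc q + o
          βb≡ = offset (suc q) (≤-trans (m≤m+n (suc q) |w|) (≰⇒> βb≰q+|w|))
          |w|≤o : |w| ≤ o
          |w|≤o = +-cancelˡ-≤ (suc q) |w| o (subst (suc q + |w| ≤_) βb≡ (≰⇒> βb≰q+|w|))
          o≤k : o ≤ k
          o≤k = +-cancelˡ-≤ (suc q) o k (subst (_≤ suc q + k) βb≡ βb≤)
          after : β a < suc p + o
          after = s≤s (≤-trans βa≤ (+-monoʳ-≤ p |w|≤o))

      case-bispecial : ∀ m → suc p + k < β (suc m) → β m ≤ p + |w| → ⊥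
      case-bispecial m <βm+1 βm≤p+|w| with block-of (suc q + k) (≤-trans (|w|≤q+ k) (n≤1+n (q + k)))
      ... | m′ , βm′≤ , <βm′+1 =
        asymA (Equivalence.from (oc z (bispecial Tp≢Tq Ty≢Ty′ xzy∈L x′zy′∈L) (T p) (T q) _ _ Tp≢Tq Ty≢Ty′ xzy∈L x′zy′∈L) differ) inverted
        where
          z = window T (suc p) k
          Tp≢Tq : T p ≢ T q
          Tp≢Tq e = asymA inverted (subst₂ _<A_ (sym e) e inverted)
          Ty≢Ty′ : T (suc p + k) ≢ T (suc q + k)
          Ty≢Ty′ e = irreflD e differ
          xzy∈L : L (T p ∷ z ++ [ T (suc p + k) ])
          xzy∈L = letters∈L p k m (|w|≤β <βm+1 (≤-trans B≤p (≤-trans (n≤1+n p) (m≤m+n (suc p) k)))) βm≤p+|w| <βm+1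
          βm′≤q+|w| : β m′ ≤ q + |w|
          βm′≤q+|w| = q-block-starts-early m m′ βm≤p+|w| βm′≤ λ o βm′≡ →
            ≤-<-trans (+-monoʳ-≤ (suc p) (+-cancelˡ-≤ (suc q) o k (subst (_≤ suc q + k) βm′≡ βm′≤))) <βm+1
          x′zy′∈L : L (T q ∷ z ++ [ T (suc q + k) ])
          x′zy′∈L = subst (λ z′ → L (T q ∷ z′ ++ [ T (suc q + k) ])) (sym (window-cong T T (suc p) (suc q) k agree))
            (letters∈L q k m′ (|w|≤β <βm′+1 (≤-trans B≤q (≤-trans (n≤1+n q) (m≤m+n (suc q) k)))) βm′≤q+|w| <βm′+1)

      Aligned : ℕ → ℕ → Set
      Aligned a b = ∃[ o ] (β a ≡ suc p + o × β b ≡ suc q + o × |w| ≤ o × o ≤ k)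

      aligned-suc : ∀ {a b} → Aligned a b → β (suc a) ≤ suc p + k → Aligned (suc a) (suc b)
      aligned-suc {a} {b} (o , βa≡ , βb≡ , |w|≤o , o≤k) βa+1≤ = aligned (p-to-q o′ |w|≤o′ o′≤k (suc a , βa+1≡))
        where
          o′ = β (suc a) ∸ suc p
          βa+1≡ : β (suc a) ≡ suc p + o′
          βa+1≡ = offset (suc p) (≤-trans (m≤m+n (suc p) o) (≤-trans (≤-reflexive (sym βa≡)) (<⇒≤ (β-<-suc a))))
          o<o′ : o < o′
          o<o′ = +-cancelˡ-< (suc p) o o′ (subst₂ _<_ βa≡ βa+1≡ (β-<-suc a))
          |w|≤o′ : |w| ≤ o′
          |w|≤o′ = ≤-trans |w|≤o (<⇒≤ o<o′)
          o′≤k : o′ ≤ k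
          o′≤k = +-cancelˡ-≤ (suc p) o′ k (subst (_≤ suc p + k) βa+1≡ βa+1≤)
          aligned : IsBoundary (suc q + o′) → Aligned (suc a) (suc b)
          aligned (c , βc≡) = o′ , βa+1≡ , trans (cong β (sym c≡b+1)) βc≡ , |w|≤o′ , o′≤k
            where
              b<c : b < c
              b<c = cancel-< (subst₂ _<_ (sym βb≡) (sym βc≡) (+-monoʳ-< (suc q) o<o′))
              c≯b+1 : ¬ suc b < c
              c≯b+1 b+1<c = no-q-boundary a o″ (≤-trans |w|≤o (<⇒≤ o<o″)) (≤-trans (<⇒≤ o″<o′) o′≤k)
                              (subst (_< suc p + o″) (sym βa≡) (+-monoʳ-< (suc p) o<o″))
                              (subst (suc p + o″ <_) (sym βa+1≡) (+-monoʳ-< (suc p) o″<o′))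
                              (suc b , βb+1≡)
                where
                  o″ = β (suc b) ∸ suc q
                  βb+1≡ : β (suc b) ≡ suc q + o″
                  βb+1≡ = offset (suc q) (≤-trans (m≤m+n (suc q) o) (≤-trans (≤-reflexive (sym βb≡)) (<⇒≤ (β-<-suc b))))
                  o<o″ : o < o″
                  o<o″ = +-cancelˡ-< (suc q) o o″ (subst₂ _<_ βb≡ βb+1≡ (β-<-suc b))
                  o″<o′ : o″ < o′
                  o″<o′ = +-cancelˡ-< (suc q) o″ o′ (subst₂ _<_ βb+1≡ βc≡ (mono-< b+1<c))
              c≡b+1 : c ≡ suc b
              c≡b+1 = ≤-antisym (≮⇒≥ c≯b+1) b<c

      aligned-walk : ∀ {a b m} → Aligned a b → β m ≤ suc p + k → ∀ l → l + a ≤ m → Aligned (l + a) (l + b)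
      aligned-walk ab βm≤ zero    _    = ab
      aligned-walk ab βm≤ (suc l) l+a<m =
        aligned-suc (aligned-walk ab βm≤ l (≤-trans (n≤1+n _) l+a<m)) (≤-trans (mono-≤ l+a<m) βm≤)

      aligned-letters : ∀ {a b} → Aligned a b → Aligned (suc a) (suc b) → V a ≡ V b
      aligned-letters {a} {b} (o , βa≡ , βb≡ , _ , _) (o′ , βa+1≡ , βb+1≡ , _ , o′≤k) = injective (begin
        ψ (V a)                          ≡⟨ block a ⟨
        window T (β a) (length (ψ (V a))) ≡⟨ cong (λ x → window T x (length (ψ (V a)))) βa≡ ⟩
        window T (suc p + o) ℓ           ≡⟨ window-cong T T (suc p + o) (suc q + o) ℓ (λ i i<ℓ →
                                              trans (cong T (+-assoc (suc p) o i)) (trans (agree (o + i) (<-≤-trans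
                                                (subst (o + i <_) o+ℓa≡o′ (+-monoʳ-< o i<ℓ)) o′≤k)) (cong T (sym (+-assoc (suc q) o i))))) ⟩
        window T (suc q + o) ℓ           ≡⟨ cong₂ (window T) (sym βb≡) ℓa≡ℓb ⟩
        window T (β b) (length (ψ (V b))) ≡⟨ block b ⟩
        ψ (V b)                          ∎)
        where
          open ≡-Reasoning
          ℓ = length (ψ (V a))
          o+ℓ≡o′ : ∀ {c x} → β c ≡ x + o → β (suc c) ≡ x + o′ → o + length (ψ (V c)) ≡ o′
          o+ℓ≡o′ {c} {x} βc≡ βc+1≡ = +-cancelˡ-≡ x _ _
            (trans (sym (+-assoc x o _)) (trans (cong (_+ length (ψ (V c))) (sym βc≡)) (trans (sym (β-suc c)) βc+1≡)))
          o+ℓa≡o′ : o + ℓ ≡ o′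
          o+ℓa≡o′ = o+ℓ≡o′ βa≡ βa+1≡
          ℓa≡ℓb : ℓ ≡ length (ψ (V b))
          ℓa≡ℓb = +-cancelˡ-≡ o _ _ (trans o+ℓa≡o′ (sym (o+ℓ≡o′ βb≡ βb+1≡)))

      agree-window : ∀ o → o ≤ k → window T (suc q) o ≡ window T (suc p) o
      agree-window o o≤k = window-cong T T (suc q) (suc p) o (λ i i<o → sym (agree i (<-≤-trans i<o o≤k)))

      letters-before : ∀ a b o → β a ≤ p + |w| → β (suc a) ≡ suc p + o → β b ≤ q + |w| → β (suc b) ≡ suc q + o →
                       o ≤ k → V b <Aw V a
      letters-before a b o βa≤ βa+1≡ βb≤ βb+1≡ o≤k = Equivalence.from Aw⇔
        (_ , _ , T q , T p , window T (suc p) o ,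
         trans (split b q B≤q βb≤ βb+1≡) (cong (λ t → _ ++ T q ∷ t) (agree-window o o≤k)) ,
         split a p B≤p βa≤ βa+1≡ , inverted)
        where
          split : ∀ c x → maxBlock + |w| ≤ x → β c ≤ x + |w| → β (suc c) ≡ suc x + o →
                  w ++ ψ (V c) ≡ window T (β c ∸ |w|) (x ∸ (β c ∸ |w|)) ++ T x ∷ window T (suc x) o
          split c x bound≤x βc≤ βc+1≡ =
            trans (w++block-split c x (|w|≤β x<βc+1 bound≤x) (≤-trans (∸-monoˡ-≤ |w| βc≤) (≤-reflexive (m+n∸n≡m x |w|))) x<βc+1)
                  (cong (λ e → window T (β c ∸ |w|) (x ∸ (β c ∸ |w|)) ++ T x ∷ window T (suc x) e)
                        (trans (cong (_∸ suc x) βc+1≡) (m+n∸m≡n (suc x) o)))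
            where
              x<βc+1 : x < β (suc c)
              x<βc+1 = subst (x <_) (sym βc+1≡) (s≤s (m≤m+n x o))

      letters-after : ∀ a b o → β a ≡ suc p + o → β b ≡ suc q + o → o ≤ k →
                      suc p + k < β (suc a) → suc q + k < β (suc b) → V a <Dw V b
      letters-after a b o βa≡ βb≡ o≤k <βa+1 <βb+1 = Equivalence.from Dw⇔ (Equivalence.from Lex<⇔LexDiff
        (subst₂ (LexDiff _<D_) (block a) (block b)
          (LexDiff-window⁺ T (β a) (β b) (d<ℓ a p βa≡ <βa+1) (d<ℓ b q βb≡ <βb+1)
            (λ i i<d → trans (cong T (trans (cong (_+ i) βa≡) (+-assoc (suc p) o i)))
                       (trans (agree (o + i) (subst (o + i <_) o+d≡k (+-monoʳ-< o i<d)))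
                              (cong T (sym (trans (cong (_+ i) βb≡) (+-assoc (suc q) o i))))))
            (subst₂ _<D_ (at a p βa≡) (at b q βb≡) differ))))
        where
          d = k ∸ o
          o+d≡k : o + d ≡ k
          o+d≡k = m+[n∸m]≡n o≤k
          at : ∀ c x → β c ≡ suc x + o → T (suc x + k) ≡ T (β c + d)
          at c x βc≡ = cong T (sym (trans (cong (_+ d) βc≡) (trans (+-assoc (suc x) o d) (cong (suc x +_) o+d≡k))))
          d<ℓ : ∀ c x → β c ≡ suc x + o → suc x + k < β (suc c) → d < length (ψ (V c))
          d<ℓ c x βc≡ <βc+1 = +-cancelˡ-< (β c) d _ (subst₂ _<_
            (trans (cong (suc x +_) (sym o+d≡k)) (trans (sym (+-assoc (suc x) o d)) (cong (_+ d) (sym βc≡)))) (β-suc c) <βc+1)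

      q-block-ends-late : ∀ a b o → β a ≡ suc p + o → β b ≡ suc q + o → |w| ≤ o →
                          suc p + k < β (suc a) → suc q + k < β (suc b)
      q-block-ends-late a b o βa≡ βb≡ |w|≤o <βa+1 with suc (suc q + k) ≤? β (suc b)
      ... | yes <βb+1 = <βb+1
      ... | no  ≮βb+1 = ⊥-elim (no-q-boundary a o′ (≤-trans |w|≤o (<⇒≤ o<o′)) o′≤k
                          (subst (_< suc p + o′) (sym βa≡) (+-monoʳ-< (suc p) o<o′))
                          (≤-<-trans (+-monoʳ-≤ (suc p) o′≤k) <βa+1) (suc b , βb+1≡))
        where
          o′ = β (suc b) ∸ suc q
          βb+1≡ : β (suc b) ≡ suc q + o′
          βb+1≡ = offset (suc q) (≤-trans (m≤m+n (suc q) o) (≤-trans (≤-reflexive (sym βb≡)) (<⇒≤ (β-<-suc b))))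
          o<o′ : o < o′
          o<o′ = +-cancelˡ-< (suc q) o o′ (subst₂ _<_ βb≡ βb+1≡ (β-<-suc b))
          o′≤k : o′ ≤ k
          o′≤k = +-cancelˡ-≤ (suc q) o′ k (subst (_≤ suc q + k) βb+1≡ (≤-pred (≰⇒> ≮βb+1)))

      module CaseSynchronised (m : ℕ) (βm≤ : β m ≤ suc p + k) (<βm+1 : suc p + k < β (suc m)) (p+|w|<βm : p + |w| < β m)
                   (e : ℕ) (βe≤ : β e ≤ p + |w|) (<βe+1 : p + |w| < β (suc e)) where

        private
          o = β (suc e) ∸ suc p

          βe+1≡ : β (suc e) ≡ suc p + o
          βe+1≡ = offset (suc p) (≤-trans (m≤m+n (suc p) |w|) <βe+1)

          |w|≤o : |w| ≤ o
          |w|≤o = +-cancelˡ-≤ (suc p) |w| o (subst (suc p + |w| ≤_) βe+1≡ <βe+1)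

          e<m : e < m
          e<m = cancel-< (≤-<-trans βe≤ p+|w|<βm)

          o≤k : o ≤ k
          o≤k = +-cancelˡ-≤ (suc p) o k (subst (_≤ suc p + k) βe+1≡ (≤-trans (mono-≤ e<m) βm≤))

          K = m ∸ suc e

          K+e+1≡m : K + suc e ≡ m
          K+e+1≡m = m∸n+n≡m e<m

        matched : ∀ e′ → β (suc e′) ≡ suc q + o → ⊥
        matched e′ βe′+1≡ = free record
          { p = e ; q = e′ ; k = K ; B≤p = z≤n ; B≤q = z≤n
          ; agree    = λ l l<K → subst₂ (λ x y → V x ≡ V y) (+-comm l (suc e)) (+-comm l (suc e′))
                         (aligned-letters (walk l (≤-trans (n≤1+n _) (l+e+1<m l<K))) (walk (suc l) (l+e+1<m l<K)))
          ; differ   = subst₂ (λ x y → V x <Dw V y) (trans (sym K+e+1≡m) (+-comm K (suc e))) (+-comm K (suc e′)) last-blocks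
          ; inverted = letters-before e e′ o βe≤ βe+1≡ βe′≤ βe′+1≡ o≤k
          }
          where
            walk : ∀ l → l + suc e ≤ m → Aligned (l + suc e) (l + suc e′)
            walk = aligned-walk (o , βe+1≡ , βe′+1≡ , |w|≤o , o≤k) βm≤
            l+e+1<m : ∀ {l} → l < K → suc l + suc e ≤ m
            l+e+1<m l<K = subst (suc _ ≤_) K+e+1≡m (+-monoˡ-≤ (suc e) l<K)
            βe′≤ : β e′ ≤ q + |w|
            βe′≤ = q-block-starts-early e e′ βe≤ (≤-trans (<⇒≤ (β-<-suc e′)) (subst (_≤ suc q + k) (sym βe′+1≡) (+-monoʳ-≤ (suc q) o≤k)))
              λ o′ βe′≡ → subst (suc p + o′ <_) (sym βe+1≡)
                (+-monoʳ-< (suc p) (+-cancelˡ-< (suc q) o′ o (subst₂ _<_ βe′≡ βe′+1≡ (β-<-suc e′))))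
            last-blocks : V m <Dw V (K + suc e′)
            last-blocks with walk K (≤-reflexive K+e+1≡m)
            ... | oK , βm≡ , βK≡ , |w|≤oK , oK≤k =
              letters-after m (K + suc e′) oK βm≡′ βK≡ oK≤k <βm+1 (q-block-ends-late m (K + suc e′) oK βm≡′ βK≡ |w|≤oK <βm+1)
              where
                βm≡′ = trans (cong β (sym K+e+1≡m)) βm≡

        contradiction : ⊥
        contradiction with p-to-q o |w|≤o o≤k (suc e , βe+1≡)
        ... | zero   , β0≡ = <⇒≱ (≤-<-trans β-zero (≤-<-trans |w|≤o (m<n+m o (s≤s z≤n)))) (≤-reflexive (sym β0≡))
        ... | suc e′ , βe′+1≡ = matched e′ βe′+1≡

      contradiction : ⊥
      contradiction with block-of (suc p + k) (≤-trans (|w|≤p+ k) (n≤1+n (p + k)))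
      ... | m , βm≤ , <βm+1 with β m ≤? p + |w|
      ...   | yes βm≤p+|w| = case-bispecial m <βm+1 βm≤p+|w|
      ...   | no  βm≰p+|w| with block-of (p + |w|) (m≤n+m |w| p)
      ...     | e , βe≤ , <βe+1 = CaseSynchronised.contradiction m βm≤ <βm+1 (≰⇒> βm≰p+|w|) e βe≤ <βe+1

    inversionFree-lifts : Asymmetric _<A_ → Irreflexive _≡_ _<D_ → OrderCondition L _<A_ _<D_ →
                          InversionFree V _<Aw_ _<Dw_ 0 → InversionFree T _<A_ _<D_ (maxBlock + |w|)
    inversionFree-lifts asymA irreflD oc free inv = InversionInT.contradiction asymA irreflD oc free inv

module MorphicClusters
  {r s : ℕ} {_<A_ _<D_ : Rel (Fin r) 0ℓ} {_<Aw_ _<Dw_ : Rel (Fin s) 0ℓ}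
  (stoA : IsStrictTotalOrder _≡_ _<A_) (stoD : IsStrictTotalOrder _≡_ _<D_)
  (stoAw : IsStrictTotalOrder _≡_ _<Aw_) (stoDw : IsStrictTotalOrder _≡_ _<Dw_)
  {L : Language r} (isL : IsLanguage L) (oc : OrderCondition L _<A_ _<D_)
  {w : Word r} {φ ψ : Fin s → Word r} (family : SuffixReturnFamily L w ψ)
  (Aw⇔ : ∀ {i j} → i <Aw j ⇔ AntiLex< _<A_ (w ++ ψ i) (w ++ ψ j))
  (Dw⇔ : ∀ {i j} → i <Dw j ⇔ Lex< _<D_ (ψ i) (ψ j))
  (φ-nonempty : ∀ i → 0 < length (φ i))
  (coding : ∀ b v′ c u′ → morph φ (b ∷ v′) ≡ c ∷ u′ → BlockCoding w ψ (Periodic.T c u′) (Periodic.T b v′))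
  where

  private
    module SA = IsStrictTotalOrder stoA
    module SD = IsStrictTotalOrder stoD

  morph-∷ : ∀ b v′ → ∃[ c ] ∃[ u′ ] (morph φ (b ∷ v′) ≡ c ∷ u′)
  morph-∷ b v′ with φ b | φ-nonempty b
  ... | c ∷ x | _ = c , x ++ morph φ v′ , refl

  clusters-morph⇔ : ∀ v → Clusters _<A_ _<D_ (morph φ v) ⇔ Clusters _<Aw_ _<Dw_ v
  clusters-morph⇔ []       = mk⇔ (λ _ → clusters-[] stoAw stoDw) (λ _ → clusters-[] stoA stoD)
  clusters-morph⇔ (b ∷ v′) with morph-∷ b v′
  ... | c , u′ , φv≡u = mk⇔
    (Equivalence.from (clusters⇔inversionFree stoAw stoDw b v′ |w|) ∘ inversionFree-descends Aw⇔ Dw⇔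
       ∘ Equivalence.to (clusters⇔inversionFree stoA stoD c u′ 0) ∘ subst (Clusters _<A_ _<D_) φv≡u)
    (subst (Clusters _<A_ _<D_) (sym φv≡u) ∘ Equivalence.from (clusters⇔inversionFree stoA stoD c u′ (maxBlock + |w|))
       ∘ inversionFree-lifts Aw⇔ Dw⇔ SA.asym SD.irrefl oc ∘ Equivalence.to (clusters⇔inversionFree stoAw stoDw b v′ 0))
    where
      open Transfer isL family (coding b v′ c u′ φv≡u)
      open BlockCoding (coding b v′ c u′ φv≡u) using (maxBlock)

module _ {r s : ℕ} {_<A_ _<D_ : Rel (Fin r) 0ℓ}
         (stoA : IsStrictTotalOrder _≡_ _<A_) (stoD : IsStrictTotalOrder _≡_ _<D_)
         {L : Language r} {w : Word r} {φ : Fin s → Word r} (φ-injective : ∀ {i j} → φ i ≡ φ j → i ≡ j) where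

  module SuffixReturnWords (returns : ∀ i → SuffixReturnWord L w (φ i)) where

    family : SuffixReturnFamily L w φ
    family = record
      { inL            = λ i → proj₁ (proj₂ (returns i))
      ; twoOccurrences = λ i → proj₁ (proj₂ (proj₂ (returns i)))
      ; endsWith       = λ i → proj₂ (proj₂ (proj₂ (proj₂ (returns i))))
      ; injective      = φ-injective
      }

    open SuffixReturnFamily family

    derivedA-isStrictTotalOrder : IsStrictTotalOrder _≡_ (DerivedA _<A_ φ w)
    derivedA-isStrictTotalOrder = isStrictTotalOrder-via-LexDiff stoA _ (λ i → reverse (w ++ φ i)) AntiLex<⇔LexDiff-reverse
      (λ e → injective (++-cancelˡ w _ _ (reverse-injective e))) (¬properSuffix ∘ properPrefix-reverse⇒properSuffix)

    derivedD-isStrictTotalOrder : IsStrictTotalOrder _≡_ (DerivedD _<D_ φ w)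
    derivedD-isStrictTotalOrder = isStrictTotalOrder-via-LexDiff stoD _ (λ i → φ i ++ w) Lex<⇔LexDiff
      (λ e → injective (++-cancelʳ w _ _ e)) (¬properPrefix ∘ properPrefix-++ʳ⁻ w)

    derivedA⇔ : ∀ {i j} → DerivedA _<A_ φ w i j ⇔ AntiLex< _<A_ (w ++ φ i) (w ++ φ j)
    derivedA⇔ = mk⇔ id id

    derivedD⇔ : ∀ {i j} → DerivedD _<D_ φ w i j ⇔ Lex< _<D_ (φ i) (φ j)
    derivedD⇔ = Lex<-++ʳ⇔ stoD w ¬properPrefix ¬properPrefix

    φ-nonempty : ∀ i → 0 < length (φ i)
    φ-nonempty = nonempty

    coding : ∀ b v′ c u′ → morph φ (b ∷ v′) ≡ c ∷ u′ → BlockCoding w φ (Periodic.T c u′) (Periodic.T b v′)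
    coding b v′ c u′ φv≡u = MorphicImage.suffixCoding φ b v′ c u′ φv≡u w endsWith

  module PrefixReturnWords (returns : ∀ i → PrefixReturnWord L w (φ i)) where

    -- φ i w = w ψ i, so the ψ i are suffix return words of w and (φ v)^ω is coded by ψ-blocks
    -- shifted by |w|; this reduces the prefix case to the suffix case.
    ψ : Fin s → Word r
    ψ i = proj₁ (proj₁ (proj₂ (proj₂ (proj₂ (returns i)))))

    w++ψ≡φ++w : ∀ i → w ++ ψ i ≡ φ i ++ w
    w++ψ≡φ++w i = proj₂ (proj₁ (proj₂ (proj₂ (proj₂ (returns i)))))

    family : SuffixReturnFamily L w ψ
    family = record
      { inL            = λ i → subst L (sym (w++ψ≡φ++w i)) (proj₁ (proj₂ (returns i)))
      ; twoOccurrences = λ i → subst (λ x → occurrences w x ≡ 2) (sym (w++ψ≡φ++w i)) (proj₁ (proj₂ (proj₂ (returns i))))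
      ; endsWith       = λ i → φ i , sym (w++ψ≡φ++w i)
      ; injective      = λ {i} {j} e → φ-injective (++-cancelʳ w _ _
                           (trans (sym (w++ψ≡φ++w i)) (trans (cong (w ++_) e) (w++ψ≡φ++w j))))
      }

    open SuffixReturnFamily family

    φ-¬properSuffix : ∀ {i j} → ¬ ProperSuffix (φ i) (φ j)
    φ-¬properSuffix {i} {j} = ¬properSuffix ∘ subst₂ ProperSuffix (sym (w++ψ≡φ++w i)) (sym (w++ψ≡φ++w j)) ∘ properSuffix-++ʳ⁺ w

    derivedA-isStrictTotalOrder : IsStrictTotalOrder _≡_ (DerivedA _<A_ φ w)
    derivedA-isStrictTotalOrder = isStrictTotalOrder-via-LexDiff stoA _ (λ i → reverse (w ++ φ i)) AntiLex<⇔LexDiff-reverse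
      (λ e → φ-injective (++-cancelˡ w _ _ (reverse-injective e)))
      (φ-¬properSuffix ∘ properSuffix-++ˡ⁻ w ∘ properPrefix-reverse⇒properSuffix)

    derivedD-isStrictTotalOrder : IsStrictTotalOrder _≡_ (DerivedD _<D_ φ w)
    derivedD-isStrictTotalOrder = isStrictTotalOrder-via-LexDiff stoD _ (λ i → φ i ++ w) Lex<⇔LexDiff
      (λ e → φ-injective (++-cancelʳ w _ _ e))
      (λ {i} {j} → ¬properPrefix ∘ properPrefix-++ˡ⁻ w ∘ subst₂ ProperPrefix (sym (w++ψ≡φ++w i)) (sym (w++ψ≡φ++w j)))

    derivedA⇔ : ∀ {i j} → DerivedA _<A_ φ w i j ⇔ AntiLex< _<A_ (w ++ ψ i) (w ++ ψ j)
    derivedA⇔ {i} {j} = subst₂-⇔ (AntiLex< _<A_) (sym (w++ψ≡φ++w i)) (sym (w++ψ≡φ++w j))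
      ⇔-∘ (⇔-sym (AntiLex<-++ʳ⇔ stoA w) ⇔-∘ AntiLex<-++ˡ⇔ stoA w φ-¬properSuffix φ-¬properSuffix)

    derivedD⇔ : ∀ {i j} → DerivedD _<D_ φ w i j ⇔ Lex< _<D_ (ψ i) (ψ j)
    derivedD⇔ {i} {j} = Lex<-++ˡ⇔ stoD w ⇔-∘ subst₂-⇔ (Lex< _<D_) (sym (w++ψ≡φ++w i)) (sym (w++ψ≡φ++w j))

    φ-nonempty : ∀ i → 0 < length (φ i)
    φ-nonempty i = +-cancelʳ-< (length w) 0 (length (φ i))
      (subst (length w <_) (length-++ (φ i)) (twoOccurrences⇒longer w (φ i ++ w) (proj₁ (proj₂ (proj₂ (returns i))))))

    coding : ∀ b v′ c u′ → morph φ (b ∷ v′) ≡ c ∷ u′ → BlockCoding w ψ (Periodic.T c u′) (Periodic.T b v′)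
    coding b v′ c u′ φv≡u = MorphicImage.prefixCoding φ b v′ c u′ φv≡u w φ-nonempty (λ i → proj₁ (proj₂ (proj₂ (proj₂ (returns i)))))

theorem2 : (r : ℕ) (_<A_ _<D_ : Rel (Fin r) 0ℓ) →
    IsStrictTotalOrder _≡_ _<A_ → IsStrictTotalOrder _≡_ _<D_ →
    (L : Language r) → IsLanguage L → OrderCondition L _<A_ _<D_ →
    (w : Word r) → L w →
    (s : ℕ) → 1 ≤ s → s ≤ r →
    (φ : Fin s → Word r) → (∀ i j → φ i ≡ φ j → i ≡ j) →
    ((∀ i → SuffixReturnWord L w (φ i)) ⊎ (∀ i → PrefixReturnWord L w (φ i))) →
    IsStrictTotalOrder _≡_ (DerivedA _<A_ φ w) ×
    IsStrictTotalOrder _≡_ (DerivedD _<D_ φ w) ×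
    (∀ (v : Word s) →
      Clusters _<A_ _<D_ (morph φ v) ⇔ Clusters (DerivedA _<A_ φ w) (DerivedD _<D_ φ w) v)
theorem2 r _<A_ _<D_ stoA stoD L isL oc w _ s _ _ φ φ-injective (inj₁ returns) =
  derivedA-isStrictTotalOrder , derivedD-isStrictTotalOrder ,
  MorphicClusters.clusters-morph⇔ stoA stoD derivedA-isStrictTotalOrder derivedD-isStrictTotalOrder isL oc
    family derivedA⇔ derivedD⇔ φ-nonempty coding
  where open SuffixReturnWords stoA stoD {L = L} {w} {φ} (φ-injective _ _) returns
theorem2 r _<A_ _<D_ stoA stoD L isL oc w _ s _ _ φ φ-injective (inj₂ returns) =
  derivedA-isStrictTotalOrder , derivedD-isStrictTotalOrder ,
  MorphicClusters.clusters-morph⇔ stoA stoD derivedA-isStrictTotalOrder derivedD-isStrictTotalOrder isL oc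
    family derivedA⇔ derivedD⇔ φ-nonempty coding
  where open PrefixReturnWords stoA stoD {L = L} {w} {φ} (φ-injective _ _) returns
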